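{- Let $k\ge 3$ and let $G_k$ be a complete $k$-partite graph. Then $G_k$ is strictly $k$-colorable if and only if $G_k$ contains at least one of $K_{3*k}$, $K_{2,4,6*(k-2)}$, or $K_{2,5*(k-1)}$ as a subgraph.
   Context: Graphs are finite and simple. An integer partition $\lambda$ of a positive integer $k$ is a multiset of positive integers summing to $k$; the notation $a*b$ denotes $b$ copies of $a$, so e.g. $\{1*(k-2),2\}$ is the partition consisting of $k-2$ ones and one $2$. Similarly $K_{a*b}$ denotes the complete $b$-partite graph with all parts of size $a$, and e.g. $K_{2,4,6*(k-2)}$ is the complete $k$-partite graph with parts of sizes $2,4$ and $k-2$ parts of size $6$, and $K_{2,5*(k-1)}$ has one part of size $2$ and $k-1$ parts of size $5$. A $k$-assignment $L$ of $G$ assigns to each vertex $v$ a set $L(v)$ of $k$ colors; $G$ is $L$-colorable if there is a proper coloring with each vertex $v$ receiving a color from $L(v)$. For an integer partition $\lambda=\{k_1,\dots,k_t\}$ of $k$, a $\lambda$-assignment of $G$ is a $k$-assignment $L$ such that the set $\bigcup_{v}L(v)$ can be partitioned into sets $C_1,\dots,C_t$ with $|L(v)\cap C_i|=k_i$ for every vertex $v$ and every $i$. $G$ is $\lambda$-choosable if $G$ is $L$-colorable for every $\lambda$-assignment $L$. (It is known that $G$ is $\{1*k\}$-choosable iff $G$ is $k$-colorable.) A graph $G$ is strictly $k$-colorable if $\{1*k\}$ is the only integer partition $\lambda$ of $k$ for which $G$ is $\lambda$-choosable, i.e. $G$ is $\{1*k\}$-choosable and $G$ is not $\lambda$-choosable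 for any other partition $\lambda$ of $k$. -}

module Defs where

open import Data.Nat using (ℕ; _≤_)
open import Data.Fin using (Fin) renaming (_≟_ to _≟ᶠ_)
open import Data.List using (List; length; lookup; filter; replicate)
open import Data.Nat.ListAction using (sum)
open import Data.List.Relation.Unary.All using (All)
open import Data.List.Relation.Unary.Unique.Propositional using (Unique)
open import Data.List.Membership.Propositional using (_∈_)
open import Data.List.Relation.Binary.Permutation.Propositional using (_↭_)
open import Data.Product using (Σ; _×_; proj₁)
open import Relation.Binary.PropositionalEquality using (_≡_; _≢_)
open import Function.Definitions using (Injective)

record Graph : Set₁ where
  field
    V   : Set
    Adj : V → V → Set
open Graph public

CompleteMultipartite : List ℕ → Graph
CompleteMultipartite ps = record
  { V   = Σ (Fin (length ps)) (λ i → Fin (lookup ps i))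
  ; Adj = λ u v → proj₁ u ≢ proj₁ v }

IsSubgraph : Graph → Graph → Set
IsSubgraph H G =
  Σ (V H → V G) λ f → Injective _≡_ _≡_ f × (∀ u v → Adj H u v → Adj G (f u) (f v))

IsPartition : ℕ → List ℕ → Set
IsPartition k lam = All (1 ≤_) lam × sum lam ≡ k

countIn : {t : ℕ} → (ℕ → Fin t) → Fin t → List ℕ → ℕ
countIn c i xs = length (filter (λ x → c x ≟ᶠ i) xs)

IsAssignment : ℕ → (G : Graph) → (V G → List ℕ) → Set
IsAssignment k G L = ∀ v → Unique (L v) × length (L v) ≡ k

-- L is a λ-assignment: a k-assignment together with a partition of the colours
-- into classes C_1..C_t (c x = index of the class of colour x) with
-- |L(v) ∩ C_i| = λ_i for every vertex v and every i.
IsLamAssignment : ℕ → (lam : List ℕ) → (G : Graph) → (V G → List ℕ) → Set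
IsLamAssignment k lam G L =
  IsAssignment k G L ×
  Σ (ℕ → Fin (length lam)) λ c → ∀ v i → countIn c i (L v) ≡ lookup lam i

IsLColorable : (G : Graph) → (V G → List ℕ) → Set
IsLColorable G L =
  Σ (V G → ℕ) λ φ → (∀ v → φ v ∈ L v) × (∀ u v → Adj G u v → φ u ≢ φ v)

IsLamChoosable : ℕ → List ℕ → Graph → Set
IsLamChoosable k lam G = ∀ L → IsLamAssignment k lam G L → IsLColorable G L

IsStrictlyColorable : ℕ → Graph → Set
IsStrictlyColorable k G =
  IsLamChoosable k (replicate k 1) G ×
  (∀ lam → IsPartition k lam → IsLamChoosable k lam G → lam ↭ replicate k 1)

-- Every complete k-partite graph is {1*k}-choosable: part i takes its colour from class i.
--
-- If no part has size 1, no two parts have sizes 2 and ≤ 3, and no three parts have sizes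
-- 2, ≤ 4 and ≤ 5, then one of K_{3*k}, K_{2,4,6*(k-2)}, K_{2,5*(k-1)} sits inside G.  Each of the
-- three excluded situations makes G {2,1*(k-2)}-choosable: the two or three special parts are coloured
-- from the class of size two (and one singleton class), every other part from a singleton class
-- of its own, and the case analysis on the class-two pairs of the special vertices is a pigeonhole
-- argument.
--
-- Conversely, let λ be a partition of k with a part λ_p ≥ 2 and H one of the three graphs.  Give
-- each vertex of H two of four reserved colours of class p, following a fixed pattern of pairs per
-- part, plus the same k - 2 shared colours.  A colouring uses shared colours on at most k - 2
-- parts of H, so two parts are coloured from their reserved pairs alone, and the patterns are
-- chosen so that this always produces a monochromatic edge.

module Submission where

open import Defs
open import Data.Nat using (ℕ; zero; suc; pred; _≤_; _<_; _∸_; _+_; _*_; z≤n; s≤s; _≤?_) renaming (_≟_ to _≟ℕ_)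
import Data.Nat.Properties as ℕ
open import Data.Nat.DivMod using (m%n<n; [m+kn]%n≡m%n; m<n⇒m%n≡m)
open import Data.Nat.ListAction using (sum)
open import Data.Fin using (Fin; zero; suc; toℕ; cast; fromℕ<; inject≤; punchIn; punchOut) renaming (_≟_ to _≟ᶠ_)
import Data.Fin.Properties as Fin
open import Data.List using (List; []; _∷_; _++_; length; lookup; replicate)
open import Data.List.Properties using (length-replicate; length-++)
open import Data.List.Relation.Unary.All as All using (All; []; _∷_)
open import Data.List.Relation.Unary.All.Properties using (replicate⁺; ¬Any⇒All¬)
open import Data.List.Relation.Unary.AllPairs using ([]; _∷_)
open import Data.List.Relation.Unary.Any as Any using (here; there)
open import Data.List.Relation.Unary.Any.Properties using (lookup-index)
open import Data.List.Relation.Unary.Unique.Propositional using (Unique)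
import Data.List.Relation.Unary.Unique.Propositional.Properties as Unique
open import Data.List.Membership.Propositional using (_∈_; _∉_)
open import Data.List.Membership.Propositional.Properties using (∈-++⁻)
open import Data.List.Membership.DecPropositional _≟ℕ_ using (_∈?_)
open import Data.List.Relation.Binary.Permutation.Propositional using (_↭_; ↭-refl)
open import Data.List.Relation.Binary.Permutation.Propositional.Properties using (∈-resp-↭)
open import Data.Fin.Subset using (Subset) renaming (_∈_ to _∈ˢ_)
open import Data.Fin.Subset.Properties using (anySubset?) renaming (_∈?_ to _∈ˢ?_)
open import Data.Vec as Vec using (tabulate; []; _∷_)
open import Data.Vec.Properties using (lookup∘tabulate; lookup⇒[]=; []=⇒lookup)
open import Data.Product using (Σ; ∃; ∃-syntax; _×_; _,_; proj₁; proj₂)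
open import Data.Sum using (_⊎_; inj₁; inj₂)
open import Data.Empty using (⊥; ⊥-elim)
open import Relation.Nullary using (¬_; Dec; yes; no; does)
open import Relation.Nullary.Decidable
  using (¬?; _×-dec_; _⊎-dec_; _→-dec_; decidable-stable; dec-true; from-yes; True; toWitness)
open import Relation.Binary.PropositionalEquality
open import Function.Base using (_∘_)
open import Function.Bundles using (_⇔_; mk⇔)
open import Function.Definitions using (Injective)

private variable n : ℕ

countIn-suc⇒∈ : ∀ {t} (c : ℕ → Fin t) i xs {m} → countIn c i xs ≡ suc m → ∃[ x ] x ∈ xs × c x ≡ i
countIn-suc⇒∈ c i [] ()
countIn-suc⇒∈ c i (x ∷ xs) eq with c x ≟ᶠ i
... | yes cx≡i = x , here refl , cx≡i
... | no _ = let (y , y∈xs , cy≡i) = countIn-suc⇒∈ c i xs eq in y , there y∈xs , cy≡i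

countIn≡2⇒distinct : ∀ {t} (c : ℕ → Fin t) i xs → Unique xs → countIn c i xs ≡ 2 →
  ∃[ x ] ∃[ y ] x ∈ xs × y ∈ xs × c x ≡ i × c y ≡ i × x ≢ y
countIn≡2⇒distinct c i [] _ ()
countIn≡2⇒distinct c i (x ∷ xs) (x∉xs ∷ u) eq with c x ≟ᶠ i
... | yes cx≡i = let (y , y∈xs , cy≡i) = countIn-suc⇒∈ c i xs (cong pred eq) in
  x , y , here refl , there y∈xs , cx≡i , cy≡i , All.lookup x∉xs y∈xs
... | no _ = let (x′ , y , x′∈ , y∈ , cx′ , cy , x′≢y) = countIn≡2⇒distinct c i xs u eq in
  x′ , y , there x′∈ , there y∈ , cx′ , cy , x′≢y

countIn-++ : ∀ {t} (c : ℕ → Fin t) i xs ys → countIn c i (xs ++ ys) ≡ countIn c i xs + countIn c i ys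
countIn-++ c i [] ys = refl
countIn-++ c i (x ∷ xs) ys with c x ≟ᶠ i
... | yes _ = cong suc (countIn-++ c i xs ys)
... | no _ = countIn-++ c i xs ys

countIn-homogeneous : ∀ {t} (c : ℕ → Fin t) i q xs → (∀ x → x ∈ xs → c x ≡ q) →
  (q ≡ i → countIn c i xs ≡ length xs) × (q ≢ i → countIn c i xs ≡ 0)
countIn-homogeneous c i q [] _ = (λ _ → refl) , (λ _ → refl)
countIn-homogeneous c i q (x ∷ xs) h with c x ≟ᶠ i | countIn-homogeneous c i q xs (λ z z∈ → h z (there z∈))
... | yes cx≡i | (same , _) =
  (λ q≡i → cong suc (same q≡i)) , (λ q≢i → ⊥-elim (q≢i (trans (sym (h x (here refl))) cx≡i)))
... | no cx≢i | (_ , other) = (λ q≡i → ⊥-elim (cx≢i (trans (h x (here refl)) q≡i))) , other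

cast-injective : ∀ {m n} (e : m ≡ n) {i j : Fin m} → cast e i ≡ cast e j → i ≡ j
cast-injective e {i} {j} p =
  Fin.toℕ-injective (trans (sym (Fin.toℕ-cast e i)) (trans (cong toℕ p) (Fin.toℕ-cast e j)))

lookup-replicate : ∀ {A : Set} k (x : A) (i : Fin (length (replicate k x))) → lookup (replicate k x) i ≡ x
lookup-replicate (suc k) x zero = refl
lookup-replicate (suc k) x (suc i) = lookup-replicate k x i

lookup-All : ∀ {P : ℕ → Set} {xs : List ℕ} → All P xs → ∀ i → P (lookup xs i)
lookup-All (p ∷ _) zero = p
lookup-All (_ ∷ ps) (suc i) = lookup-All ps i

no-injection-into-smaller : ∀ {a b} → b < a → (h : Fin a → Fin b) → ¬ Injective _≡_ _≡_ h
no-injection-into-smaller b<a h h-inj with Fin.pigeonhole b<a h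
... | x , y , x<y , hx≡hy = Fin.<⇒≢ x<y (h-inj hx≡hy)

injection-missing⇒smaller : ∀ {a s} (h : Fin a → Fin (suc s)) → Injective _≡_ _≡_ h → (e : Fin (suc s)) →
  (∀ x → h x ≢ e) → Σ (Fin a → Fin s) (Injective _≡_ _≡_)
injection-missing⇒smaller h h-inj e missed =
  (λ x → punchOut (≢-sym (missed x))) ,
  λ p → h-inj (Fin.punchOut-injective (≢-sym (missed _)) (≢-sym (missed _)) p)

no-injection-missing-one : ∀ {a s} (h : Fin a → Fin s) → Injective _≡_ _≡_ h → (e : Fin s) →
  (∀ x → h x ≢ e) → ¬ s ≤ a
no-injection-missing-one {s = suc s} h h-inj e missed s≤a =
  let (h′ , h′-inj) = injection-missing⇒smaller h h-inj e missed in
  no-injection-into-smaller s≤a h′ h′-inj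

no-injection-missing-two : ∀ {a s} (h : Fin a → Fin s) → Injective _≡_ _≡_ h → (e₁ e₂ : Fin s) → e₁ ≢ e₂ →
  (∀ x → h x ≢ e₁) → (∀ x → h x ≢ e₂) → ¬ s ≤ suc a
no-injection-missing-two {s = suc s} h h-inj e₁ e₂ e₁≢e₂ missed₁ missed₂ (s≤s s≤a) =
  let (h′ , h′-inj) = injection-missing⇒smaller h h-inj e₁ missed₁ in
  no-injection-missing-one h′ h′-inj (punchOut e₁≢e₂)
    (λ x e → missed₂ x (Fin.punchOut-injective (≢-sym (missed₁ x)) e₁≢e₂ e)) s≤a

punchOut-≢ : ∀ {i j x : Fin (suc n)} (i≢j : i ≢ j) (i≢x : i ≢ x) → j ≢ x → punchOut i≢j ≢ punchOut i≢x
punchOut-≢ i≢j i≢x j≢x e = j≢x (Fin.punchOut-injective i≢j i≢x e)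

punchOut₂ : {i j x : Fin (suc (suc n))} → i ≢ j → i ≢ x → j ≢ x → Fin n
punchOut₂ i≢j i≢x j≢x = punchOut (punchOut-≢ i≢j i≢x j≢x)

punchOut₂-injective : ∀ {i j x y : Fin (suc (suc n))} (i≢j : i ≢ j) i≢x j≢x i≢y j≢y →
  punchOut₂ i≢j i≢x j≢x ≡ punchOut₂ i≢j i≢y j≢y → x ≡ y
punchOut₂-injective i≢j i≢x j≢x i≢y j≢y e = Fin.punchOut-injective i≢x i≢y
  (Fin.punchOut-injective (punchOut-≢ i≢j i≢x j≢x) (punchOut-≢ i≢j i≢y j≢y) e)

punchOut₂-≢ : ∀ {i j x y : Fin (suc (suc n))} (i≢j : i ≢ j) i≢x j≢x i≢y j≢y → x ≢ y →
  punchOut₂ i≢j i≢x j≢x ≢ punchOut₂ i≢j i≢y j≢y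
punchOut₂-≢ i≢j i≢x j≢x i≢y j≢y x≢y e = x≢y (punchOut₂-injective i≢j i≢x j≢x i≢y j≢y e)

punchOut₃ : {i j l x : Fin (suc (suc (suc n)))} → i ≢ j → i ≢ l → j ≢ l → i ≢ x → j ≢ x → l ≢ x → Fin n
punchOut₃ i≢j i≢l j≢l i≢x j≢x l≢x = punchOut (punchOut₂-≢ i≢j i≢l j≢l i≢x j≢x l≢x)

punchOut₃-injective : ∀ {i j l x y : Fin (suc (suc (suc n)))} (i≢j : i ≢ j) (i≢l : i ≢ l) (j≢l : j ≢ l)
  i≢x j≢x l≢x i≢y j≢y l≢y →
  punchOut₃ i≢j i≢l j≢l i≢x j≢x l≢x ≡ punchOut₃ i≢j i≢l j≢l i≢y j≢y l≢y → x ≡ y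
punchOut₃-injective i≢j i≢l j≢l i≢x j≢x l≢x i≢y j≢y l≢y e = punchOut₂-injective i≢j i≢x j≢x i≢y j≢y
  (Fin.punchOut-injective (punchOut₂-≢ i≢j i≢l j≢l i≢x j≢x l≢x) (punchOut₂-≢ i≢j i≢l j≢l i≢y j≢y l≢y)
    e)

isSubgraph-partwise : ∀ hs ps (σ : Fin (length hs) → Fin (length ps)) → Injective _≡_ _≡_ σ →
  (∀ q → lookup hs q ≤ lookup ps (σ q)) → IsSubgraph (CompleteMultipartite hs) (CompleteMultipartite ps)
isSubgraph-partwise hs ps σ σ-inj le = f , f-inj , λ { (q , _) (q′ , _) q≢q′ e → q≢q′ (σ-inj e) }
  where
  f : V (CompleteMultipartite hs) → V (CompleteMultipartite ps)
  f (q , r) = σ q , inject≤ r (le q)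
  toℕ-snd : ∀ {a : Fin (length ps)} {x y : Fin (lookup ps a)} →
    _≡_ {A = V (CompleteMultipartite ps)} (a , x) (a , y) → toℕ x ≡ toℕ y
  toℕ-snd refl = refl
  f-inj : Injective _≡_ _≡_ f
  f-inj {q , r} {q′ , r′} e with σ-inj (cong proj₁ e)
  ... | refl = cong (q ,_) (Fin.toℕ-injective
    (trans (sym (Fin.toℕ-inject≤ r (le q))) (trans (toℕ-snd e) (Fin.toℕ-inject≤ r′ (le q)))))

K3*k-⊆ : ∀ k ps → length ps ≡ k → (∀ i → 3 ≤ lookup ps i) →
  IsSubgraph (CompleteMultipartite (replicate k 3)) (CompleteMultipartite ps)
K3*k-⊆ k ps eq ge3 = isSubgraph-partwise (replicate k 3) ps (cast e) (cast-injective e) le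
  where
  e : length (replicate k 3) ≡ length ps
  e = trans (length-replicate k) (sym eq)
  le : ∀ q → lookup (replicate k 3) q ≤ lookup ps (cast e q)
  le q = subst (_≤ lookup ps (cast e q)) (sym (lookup-replicate k 3 q)) (ge3 (cast e q))

module _ (n : ℕ) (ps : List ℕ) (eq : length ps ≡ suc (suc (suc n))) where

  private
    cI : Fin (length ps) → Fin (suc (suc (suc n)))
    cI = cast eq
    cO : Fin (suc (suc (suc n))) → Fin (length ps)
    cO = cast (sym eq)
    cI∘cO : ∀ y → cI (cO y) ≡ y
    cI∘cO y = Fin.toℕ-injective (trans (Fin.toℕ-cast eq (cO y)) (Fin.toℕ-cast (sym eq) y))

  K2,5*-⊆ : (i : Fin (length ps)) → 2 ≤ lookup ps i → (∀ j → j ≢ i → 5 ≤ lookup ps j) →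
    IsSubgraph (CompleteMultipartite (2 ∷ replicate (suc (suc n)) 5)) (CompleteMultipartite ps)
  K2,5*-⊆ i ge2 ge5 = isSubgraph-partwise (2 ∷ replicate (suc (suc n)) 5) ps σ σ-inj le
    where
    cR : Fin (length (replicate (suc (suc n)) 5)) → Fin (suc (suc n))
    cR = cast (length-replicate (suc (suc n)))
    σ : Fin (length (2 ∷ replicate (suc (suc n)) 5)) → Fin (length ps)
    σ zero = i
    σ (suc t) = cO (punchIn (cI i) (cR t))
    σ-suc≢i : ∀ t → σ (suc t) ≢ i
    σ-suc≢i t e = Fin.punchInᵢ≢i (cI i) (cR t) (trans (sym (cI∘cO _)) (cong cI e))
    σ-inj : Injective _≡_ _≡_ σ
    σ-inj {zero} {zero} _ = refl
    σ-inj {zero} {suc t} e = ⊥-elim (σ-suc≢i t (sym e))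
    σ-inj {suc t} {zero} e = ⊥-elim (σ-suc≢i t e)
    σ-inj {suc t} {suc t′} e = cong suc (cast-injective (length-replicate (suc (suc n)))
      (Fin.punchIn-injective (cI i) (cR t) (cR t′) (cast-injective (sym eq) e)))
    le : ∀ q → lookup (2 ∷ replicate (suc (suc n)) 5) q ≤ lookup ps (σ q)
    le zero = ge2
    le (suc t) = subst (_≤ lookup ps (σ (suc t))) (sym (lookup-replicate (suc (suc n)) 5 t)) (ge5 _ (σ-suc≢i t))

  K2,4,6*-⊆ : (i j : Fin (length ps)) → i ≢ j → 2 ≤ lookup ps i → 4 ≤ lookup ps j →
    (∀ l → l ≢ i → l ≢ j → 6 ≤ lookup ps l) →
    IsSubgraph (CompleteMultipartite (2 ∷ 4 ∷ replicate (suc n) 6)) (CompleteMultipartite ps)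
  K2,4,6*-⊆ i j i≢j ge2 ge4 ge6 = isSubgraph-partwise (2 ∷ 4 ∷ replicate (suc n) 6) ps σ σ-inj le
    where
    cR : Fin (length (replicate (suc n) 6)) → Fin (suc n)
    cR = cast (length-replicate (suc n))
    cIi≢cIj : cI i ≢ cI j
    cIi≢cIj e = i≢j (cast-injective eq e)
    j′ : Fin (suc (suc n))
    j′ = punchOut cIi≢cIj
    σ : Fin (length (2 ∷ 4 ∷ replicate (suc n) 6)) → Fin (length ps)
    σ zero = i
    σ (suc zero) = j
    σ (suc (suc t)) = cO (punchIn (cI i) (punchIn j′ (cR t)))
    σ-ss≢i : ∀ t → σ (suc (suc t)) ≢ i
    σ-ss≢i t e = Fin.punchInᵢ≢i (cI i) _ (trans (sym (cI∘cO _)) (cong cI e))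
    σ-ss≢j : ∀ t → σ (suc (suc t)) ≢ j
    σ-ss≢j t e = Fin.punchInᵢ≢i j′ (cR t) (Fin.punchIn-injective (cI i) _ _
      (trans (sym (cI∘cO _)) (trans (cong cI e) (sym (Fin.punchIn-punchOut cIi≢cIj)))))
    σ-inj : Injective _≡_ _≡_ σ
    σ-inj {zero} {zero} _ = refl
    σ-inj {zero} {suc zero} e = ⊥-elim (i≢j e)
    σ-inj {zero} {suc (suc t)} e = ⊥-elim (σ-ss≢i t (sym e))
    σ-inj {suc zero} {zero} e = ⊥-elim (i≢j (sym e))
    σ-inj {suc zero} {suc zero} _ = refl
    σ-inj {suc zero} {suc (suc t)} e = ⊥-elim (σ-ss≢j t (sym e))
    σ-inj {suc (suc t)} {zero} e = ⊥-elim (σ-ss≢i t e)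
    σ-inj {suc (suc t)} {suc zero} e = ⊥-elim (σ-ss≢j t e)
    σ-inj {suc (suc t)} {suc (suc t′)} e = cong (λ x → suc (suc x)) (cast-injective (length-replicate (suc n))
      (Fin.punchIn-injective j′ _ _ (Fin.punchIn-injective (cI i) _ _ (cast-injective (sym eq) e))))
    le : ∀ q → lookup (2 ∷ 4 ∷ replicate (suc n) 6) q ≤ lookup ps (σ q)
    le zero = ge2
    le (suc zero) = ge4
    le (suc (suc t)) = subst (_≤ lookup ps (σ (suc (suc t)))) (sym (lookup-replicate (suc n) 6 t))
      (ge6 _ (σ-ss≢i t) (σ-ss≢j t))

isLamChoosable-ones : ∀ k ps → length ps ≡ k → IsLamChoosable k (replicate k 1) (CompleteMultipartite ps)
isLamChoosable-ones k ps eq L (_ , c , count) = φ , φ∈L , φ-proper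
  where
  e : length ps ≡ length (replicate k 1)
  e = trans eq (sym (length-replicate k))
  pick : ∀ v → ∃[ x ] x ∈ L v × c x ≡ cast e (proj₁ v)
  pick v = countIn-suc⇒∈ c _ (L v) (trans (count v _) (lookup-replicate k 1 _))
  φ : V (CompleteMultipartite ps) → ℕ
  φ v = proj₁ (pick v)
  φ∈L : ∀ v → φ v ∈ L v
  φ∈L v = proj₁ (proj₂ (pick v))
  φ-proper : ∀ u v → proj₁ u ≢ proj₁ v → φ u ≢ φ v
  φ-proper u v u≢v φu≡φv = u≢v (cast-injective e
    (trans (sym (proj₂ (proj₂ (pick u)))) (trans (cong c φu≡φv) (proj₂ (proj₂ (pick v))))))

twoThenOnes : ℕ → List ℕ
twoThenOnes n = 2 ∷ replicate n 1

_∈₂_,_ : ℕ → ℕ → ℕ → Set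
z ∈₂ x , y = z ≡ x ⊎ z ≡ y

_∈₂?_,_ : ∀ z x y → Dec (z ∈₂ x , y)
z ∈₂? x , y = (z ≟ℕ x) ⊎-dec (z ≟ℕ y)

∉₂ : ∀ {z x y} → z ≢ x → z ≢ y → ¬ z ∈₂ x , y
∉₂ z≢x _ (inj₁ z≡x) = z≢x z≡x
∉₂ _ z≢y (inj₂ z≡y) = z≢y z≡y

choose₂ : ℕ → ℕ → ℕ → ℕ
choose₂ zero x y = x
choose₂ (suc _) x y = y

choose₂-∈₂ : ∀ b x y → choose₂ b x y ∈₂ x , y
choose₂-∈₂ zero x y = inj₁ refl
choose₂-∈₂ (suc _) x y = inj₂ refl

choose₂-injective : ∀ {x y} → x ≢ y → ∀ (a a′ : Fin 2) → choose₂ (toℕ a) x y ≡ choose₂ (toℕ a′) x y → a ≡ a′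
choose₂-injective x≢y zero zero _ = refl
choose₂-injective x≢y zero (suc zero) e = ⊥-elim (x≢y e)
choose₂-injective x≢y (suc zero) zero e = ⊥-elim (x≢y (sym e))
choose₂-injective x≢y (suc zero) (suc zero) _ = refl

bit₁ bit₂ : Fin 4 → Fin 2
bit₁ zero = zero
bit₁ (suc zero) = zero
bit₁ (suc (suc _)) = suc zero
bit₂ zero = zero
bit₂ (suc zero) = suc zero
bit₂ (suc (suc zero)) = zero
bit₂ (suc (suc (suc _))) = suc zero

fromBits : Fin 2 → Fin 2 → Fin 4
fromBits zero zero = zero
fromBits zero (suc _) = suc zero
fromBits (suc _) zero = suc (suc zero)
fromBits (suc _) (suc _) = suc (suc (suc zero))

fromBits-bits : ∀ κ → fromBits (bit₁ κ) (bit₂ κ) ≡ κ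
fromBits-bits zero = refl
fromBits-bits (suc zero) = refl
fromBits-bits (suc (suc zero)) = refl
fromBits-bits (suc (suc (suc zero))) = refl

bits-injective : ∀ κ κ′ → bit₁ κ ≡ bit₁ κ′ → bit₂ κ ≡ bit₂ κ′ → κ ≡ κ′
bits-injective κ κ′ p q = trans (sym (fromBits-bits κ)) (trans (cong₂ fromBits p q) (fromBits-bits κ′))

fin1-elim : ∀ {m} (e : m ≡ 1) (P : Fin m → Set) → P (cast (sym e) zero) → ∀ r → P r
fin1-elim refl P p zero = p

fin2-elim : ∀ {m} (e : m ≡ 2) x y (P : ℕ → Fin m → Set) →
  P x (cast (sym e) zero) → P y (cast (sym e) (suc zero)) → ∀ r → P (choose₂ (toℕ r) x y) r
fin2-elim refl x y P p₀ p₁ zero = p₀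
fin2-elim refl x y P p₀ p₁ (suc zero) = p₁

module TwoThenOnesAssignment (ps : List ℕ) (n : ℕ) (length-ps : length ps ≡ suc (suc n))
  (L : V (CompleteMultipartite ps) → List ℕ)
  (A : IsLamAssignment (suc (suc n)) (twoThenOnes n) (CompleteMultipartite ps) L) where

  G : Graph
  G = CompleteMultipartite ps

  c : ℕ → Fin (suc (length (replicate n 1)))
  c = proj₁ (proj₂ A)

  Usable₀ : V G → ℕ → Set
  Usable₀ v α = α ∈ L v × c α ≡ zero

  private
    pair : ∀ v → ∃[ x ] ∃[ y ] x ∈ L v × y ∈ L v × c x ≡ zero × c y ≡ zero × x ≢ y
    pair v = countIn≡2⇒distinct c zero (L v) (proj₁ (proj₁ A v)) (proj₂ (proj₂ A) v zero)

  X Y : V G → ℕ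
  X v = proj₁ (pair v)
  Y v = proj₁ (proj₂ (pair v))

  X-usable : ∀ v → Usable₀ v (X v)
  X-usable v = let (_ , _ , x∈ , _ , cx , _) = pair v in x∈ , cx

  Y-usable : ∀ v → Usable₀ v (Y v)
  Y-usable v = let (_ , _ , _ , y∈ , _ , cy , _) = pair v in y∈ , cy

  X≢Y : ∀ v → X v ≢ Y v
  X≢Y v = let (_ , _ , _ , _ , _ , _ , x≢y) = pair v in x≢y

  single : ∀ v (q : Fin (length (replicate n 1))) → ∃[ x ] x ∈ L v × c x ≡ suc q
  single v q = countIn-suc⇒∈ c (suc q) (L v) (trans (proj₂ (proj₂ A) v (suc q)) (lookup-replicate n 1 q))

  colour-from-special-parts : (Sp : Fin (length ps) → Set) → (∀ i → Dec (Sp i)) →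
    (g : ∀ i → ¬ Sp i → Fin (length (replicate n 1))) → (∀ i j p q → g i p ≡ g j q → i ≡ j) →
    (χ : ∀ v → Sp (proj₁ v) → ℕ) → (∀ v p → χ v p ∈ L v) →
    (∀ v p j q → c (χ v p) ≢ suc (g j q)) →
    (∀ u v p q → proj₁ u ≢ proj₁ v → χ u p ≢ χ v q) → IsLColorable G L
  colour-from-special-parts Sp Sp? g g-inj χ χ∈L χ-class χ-proper = φ , φ∈L , φ-proper
    where
    φ : V G → ℕ
    φ v with Sp? (proj₁ v)
    ... | yes p = χ v p
    ... | no q = proj₁ (single v (g (proj₁ v) q))
    φ∈L : ∀ v → φ v ∈ L v
    φ∈L v with Sp? (proj₁ v)
    ... | yes p = χ∈L v p
    ... | no q = proj₁ (proj₂ (single v (g (proj₁ v) q)))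
    φ-proper : ∀ u v → proj₁ u ≢ proj₁ v → φ u ≢ φ v
    φ-proper u v u≢v with Sp? (proj₁ u) | Sp? (proj₁ v)
    ... | yes p | yes q = χ-proper u v p q u≢v
    ... | yes p | no q = λ e → χ-class u p (proj₁ v) q (trans (cong c e) (proj₂ (proj₂ (single v _))))
    ... | no p | yes q = λ e → χ-class v q (proj₁ u) p (trans (cong c (sym e)) (proj₂ (proj₂ (single u _))))
    ... | no p | no q = λ e → u≢v (g-inj _ _ p q (Fin.suc-injective
          (trans (sym (proj₂ (proj₂ (single u _)))) (trans (cong c e) (proj₂ (proj₂ (single v _)))))))

  cast-≢ : ∀ {x y : Fin (length ps)} → x ≢ y → cast length-ps x ≢ cast length-ps y
  cast-≢ x≢y e = x≢y (cast-injective length-ps e)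

  colour-two-parts : ∀ i j → i ≢ j → (colᵢ colⱼ : V G → ℕ) →
    (∀ v → proj₁ v ≡ i → Usable₀ v (colᵢ v)) → (∀ v → proj₁ v ≡ j → Usable₀ v (colⱼ v)) →
    (∀ a b → proj₁ a ≡ i → proj₁ b ≡ j → colᵢ a ≢ colⱼ b) → IsLColorable G L
  colour-two-parts i j i≢j colᵢ colⱼ okᵢ okⱼ apart =
    colour-from-special-parts Sp (λ x → (x ≟ᶠ i) ⊎-dec (x ≟ᶠ j)) g g-inj χ χ∈L χ-class χ-proper
    where
    Sp : Fin (length ps) → Set
    Sp x = x ≡ i ⊎ x ≡ j
    i≢ : ∀ x → ¬ Sp x → cast length-ps i ≢ cast length-ps x
    i≢ x ¬sp = cast-≢ (λ e → ¬sp (inj₁ (sym e)))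
    j≢ : ∀ x → ¬ Sp x → cast length-ps j ≢ cast length-ps x
    j≢ x ¬sp = cast-≢ (λ e → ¬sp (inj₂ (sym e)))
    g : ∀ x → ¬ Sp x → Fin (length (replicate n 1))
    g x ¬sp = cast (sym (length-replicate n)) (punchOut₂ (cast-≢ i≢j) (i≢ x ¬sp) (j≢ x ¬sp))
    g-inj : ∀ x y p q → g x p ≡ g y q → x ≡ y
    g-inj x y p q e = cast-injective length-ps
      (punchOut₂-injective (cast-≢ i≢j) (i≢ x p) (j≢ x p) (i≢ y q) (j≢ y q)
      (cast-injective (sym (length-replicate n)) e))
    χ : ∀ v → Sp (proj₁ v) → ℕ
    χ v (inj₁ _) = colᵢ v
    χ v (inj₂ _) = colⱼ v
    χ-usable : ∀ v p → Usable₀ v (χ v p)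
    χ-usable v (inj₁ e) = okᵢ v e
    χ-usable v (inj₂ e) = okⱼ v e
    χ∈L : ∀ v p → χ v p ∈ L v
    χ∈L v p = proj₁ (χ-usable v p)
    χ-class : ∀ v p y q → c (χ v p) ≢ suc (g y q)
    χ-class v p y q e with trans (sym (proj₂ (χ-usable v p))) e
    ... | ()
    χ-proper : ∀ u v p q → proj₁ u ≢ proj₁ v → χ u p ≢ χ v q
    χ-proper u v (inj₁ eu) (inj₁ ev) u≢v = ⊥-elim (u≢v (trans eu (sym ev)))
    χ-proper u v (inj₁ eu) (inj₂ ev) _ = apart u v eu ev
    χ-proper u v (inj₂ eu) (inj₁ ev) _ = ≢-sym (apart v u ev eu)
    χ-proper u v (inj₂ eu) (inj₂ ev) u≢v = ⊥-elim (u≢v (trans eu (sym ev)))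

  _∈P_ : ℕ → V G → Set
  z ∈P v = z ∈₂ X v , Y v

  ∈P⇒usable : ∀ {z} v → z ∈P v → Usable₀ v z
  ∈P⇒usable v (inj₁ refl) = X-usable v
  ∈P⇒usable v (inj₂ refl) = Y-usable v

  Shared : V G → V G → Set
  Shared a b = ∃[ z ] z ∈P a × z ∈P b

  shared? : ∀ a b → Dec (Shared a b)
  shared? a b with X a ∈₂? X b , Y b | Y a ∈₂? X b , Y b
  ... | yes p | _ = yes (X a , inj₁ refl , p)
  ... | no _ | yes p = yes (Y a , inj₂ refl , p)
  ... | no ¬p | no ¬q = no λ { (_ , inj₁ refl , p) → ¬p p ; (_ , inj₂ refl , q) → ¬q q }

  Blocked : V G → ℕ → ℕ → Set
  Blocked v x y = (X v ≡ x × Y v ≡ y) ⊎ (X v ≡ y × Y v ≡ x)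

  blocked? : ∀ v x y → Dec (Blocked v x y)
  blocked? v x y = ((X v ≟ℕ x) ×-dec (Y v ≟ℕ y)) ⊎-dec ((X v ≟ℕ y) ×-dec (Y v ≟ℕ x))

  blocked⇒∈P : ∀ {v x y} → Blocked v x y → x ∈P v × y ∈P v
  blocked⇒∈P (inj₁ (p , q)) = inj₁ (sym p) , inj₂ (sym q)
  blocked⇒∈P (inj₂ (p , q)) = inj₂ (sym q) , inj₁ (sym p)

  ¬blocked-same : ∀ v z → ¬ Blocked v z z
  ¬blocked-same v z (inj₁ (p , q)) = X≢Y v (trans p (sym q))
  ¬blocked-same v z (inj₂ (p , q)) = X≢Y v (trans p (sym q))

  avoid : V G → ℕ → ℕ → ℕ
  avoid v x y with X v ≟ℕ x | X v ≟ℕ y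
  ... | no _ | no _ = X v
  ... | _ | _ = Y v

  avoid-ok : ∀ v x y → ¬ Blocked v x y → Usable₀ v (avoid v x y) × ¬ avoid v x y ∈₂ x , y
  avoid-ok v x y ¬b with X v ≟ℕ x | X v ≟ℕ y
  ... | no p | no q = X-usable v , ∉₂ p q
  ... | yes p | _ = Y-usable v , ∉₂ (λ e → X≢Y v (trans p (sym e))) (λ e → ¬b (inj₁ (p , e)))
  ... | no _ | yes q = Y-usable v , ∉₂ (λ e → ¬b (inj₂ (q , e))) (λ e → X≢Y v (trans q (sym e)))

  -- κ runs over the four ways of colouring a₁, a₂ from their class-zero pairs; a vertex blocks κ
  -- when its own pair is exactly {u κ , w κ}, so that it cannot avoid both colours.
  module Combinations (a₁ a₂ : V G) where

    u w : Fin 4 → ℕ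
    u κ = choose₂ (toℕ (bit₁ κ)) (X a₁) (Y a₁)
    w κ = choose₂ (toℕ (bit₂ κ)) (X a₂) (Y a₂)

    u∈P : ∀ κ → u κ ∈P a₁
    u∈P κ = choose₂-∈₂ (toℕ (bit₁ κ)) (X a₁) (Y a₁)

    w∈P : ∀ κ → w κ ∈P a₂
    w∈P κ = choose₂-∈₂ (toℕ (bit₂ κ)) (X a₂) (Y a₂)

    u≢w : ¬ Shared a₁ a₂ → ∀ κ κ′ → u κ ≢ w κ′
    u≢w disjoint κ κ′ e = disjoint (u κ , u∈P κ , subst (_∈P a₂) (sym e) (w∈P κ′))

    blocked-injective : ¬ Shared a₁ a₂ → ∀ b κ κ′ →
      Blocked b (u κ) (w κ) → Blocked b (u κ′) (w κ′) → κ ≡ κ′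
    blocked-injective _ b κ κ′ (inj₁ (p₁ , p₂)) (inj₁ (q₁ , q₂)) = bits-injective κ κ′
      (choose₂-injective (X≢Y a₁) (bit₁ κ) (bit₁ κ′) (trans (sym p₁) q₁))
      (choose₂-injective (X≢Y a₂) (bit₂ κ) (bit₂ κ′) (trans (sym p₂) q₂))
    blocked-injective _ b κ κ′ (inj₂ (p₁ , p₂)) (inj₂ (q₁ , q₂)) = bits-injective κ κ′
      (choose₂-injective (X≢Y a₁) (bit₁ κ) (bit₁ κ′) (trans (sym p₂) q₂))
      (choose₂-injective (X≢Y a₂) (bit₂ κ) (bit₂ κ′) (trans (sym p₁) q₁))
    blocked-injective disjoint b κ κ′ (inj₁ (p₁ , _)) (inj₂ (q₁ , _)) = ⊥-elim (u≢w disjoint κ κ′ (trans (sym p₁) q₁))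
    blocked-injective disjoint b κ κ′ (inj₂ (p₁ , _)) (inj₁ (q₁ , _)) = ⊥-elim (u≢w disjoint κ′ κ (trans (sym q₁) p₁))

    FreeFor : Fin (length ps) → Fin 4 → Set
    FreeFor j κ = ∀ r → ¬ Blocked (j , r) (u κ) (w κ)

    free? : ∀ j → Dec (∃ (FreeFor j))
    free? j = Fin.any? λ κ → Fin.all? λ r → ¬? (blocked? (j , r) (u κ) (w κ))

    Blocker : Fin (length ps) → Set
    Blocker j = ∀ κ → ∃[ r ] Blocked (j , r) (u κ) (w κ)

    blocker : ∀ j → ¬ ∃ (FreeFor j) → Blocker j
    blocker j none-free κ with Fin.any? (λ r → blocked? (j , r) (u κ) (w κ))
    ... | yes found = found
    ... | no none = ⊥-elim (none-free (κ , λ r b → none (r , b)))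

    blocker-injective : ¬ Shared a₁ a₂ → ∀ j (h : Blocker j) → Injective _≡_ _≡_ (λ κ → proj₁ (h κ))
    blocker-injective disjoint j h {κ} {κ′} e = blocked-injective disjoint (j , proj₁ (h κ′)) κ κ′
      (subst (λ r → Blocked (j , r) (u κ) (w κ)) e (proj₂ (h κ))) (proj₂ (h κ′))

    avoid-free : ∀ j κ → FreeFor j κ → ∀ v → proj₁ v ≡ j →
      Usable₀ v (avoid v (u κ) (w κ)) × ¬ avoid v (u κ) (w κ) ∈₂ u κ , w κ
    avoid-free j κ free (_ , r) refl = avoid-ok _ _ _ (free r)

  module PartOfSize2 (i : Fin (length ps)) (size-i : lookup ps i ≡ 2) where

    a₁ a₂ : V G
    a₁ = i , cast (sym size-i) zero
    a₂ = i , cast (sym size-i) (suc zero)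

    open Combinations a₁ a₂ public

    paint : ℕ → ℕ → V G → ℕ
    paint x y v = choose₂ (toℕ (proj₂ v)) x y

    paint-elim : ∀ x y (P : ℕ → V G → Set) → P x a₁ → P y a₂ → ∀ v → proj₁ v ≡ i → P (paint x y v) v
    paint-elim x y P p₁ p₂ (_ , r) refl = fin2-elim size-i x y (λ α r → P α (i , r)) p₁ p₂ r

    paint-usable : ∀ {x y} → Usable₀ a₁ x → Usable₀ a₂ y → ∀ v → proj₁ v ≡ i → Usable₀ v (paint x y v)
    paint-usable {x} {y} = paint-elim x y (λ α v → Usable₀ v α)

    paint-apart : ∀ {x y} j (col : V G → ℕ) → (∀ v → proj₁ v ≡ j → ¬ col v ∈₂ x , y) →
      ∀ a b → proj₁ a ≡ i → proj₁ b ≡ j → paint x y a ≢ col b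
    paint-apart {x} {y} j col outside a b a∈i b∈j e =
      outside b b∈j (subst (_∈₂ x , y) e
        (paint-elim x y (λ α _ → α ∈₂ x , y) (inj₁ refl) (inj₂ refl) a a∈i))

    avoid-shared : ∀ z v → Usable₀ v (avoid v z z) × ¬ avoid v z z ∈₂ z , z
    avoid-shared z v = avoid-ok v z z (¬blocked-same v z)

    colour-with-pair : ∀ j → i ≢ j → ∀ {x y} → Usable₀ a₁ x → Usable₀ a₂ y → (col : V G → ℕ) →
      (∀ v → proj₁ v ≡ j → Usable₀ v (col v) × ¬ col v ∈₂ x , y) → IsLColorable G L
    colour-with-pair j i≢j ux uy col ok = colour-two-parts i j i≢j (paint _ _) col (paint-usable ux uy)
      (λ v p → proj₁ (ok v p)) (paint-apart j col (λ v p → proj₂ (ok v p)))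

    colourable-with-≤3 : ∀ j → i ≢ j → lookup ps j ≤ 3 → IsLColorable G L
    colourable-with-≤3 j i≢j j≤3 with shared? a₁ a₂
    ... | yes (z , z∈₁ , z∈₂) = colour-with-pair j i≢j (∈P⇒usable a₁ z∈₁) (∈P⇒usable a₂ z∈₂)
      (λ v → avoid v z z) (λ v _ → avoid-shared z v)
    ... | no disjoint with free? j
    ... | yes (κ , free) = colour-with-pair j i≢j (∈P⇒usable a₁ (u∈P κ)) (∈P⇒usable a₂ (w∈P κ))
      (λ v → avoid v (u κ) (w κ)) (avoid-free j κ free)
    ... | no none-free = ⊥-elim (no-injection-into-smaller (s≤s j≤3) _
      (blocker-injective disjoint j (blocker j none-free)))

  colourable-with-size-1 : ∀ i j → i ≢ j → lookup ps i ≡ 1 → IsLColorable G L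
  colourable-with-size-1 i j i≢j size-i = colour-two-parts i j i≢j X (λ v → avoid v x₀ x₀)
    (λ v _ → X-usable v) (λ v _ → proj₁ (avoid-ok v x₀ x₀ (¬blocked-same v x₀))) apart
    where
    x₀ : ℕ
    x₀ = X (i , cast (sym size-i) zero)
    apart : ∀ a b → proj₁ a ≡ i → proj₁ b ≡ j → X a ≢ avoid b x₀ x₀
    apart (_ , r) b refl _ = fin1-elim size-i (λ r → X (i , r) ≢ avoid b x₀ x₀)
      (λ e → proj₂ (avoid-ok b x₀ x₀ (¬blocked-same b x₀)) (inj₁ (sym e))) r

module TwoThenOnesAssignment₃ (ps : List ℕ) (n : ℕ) (length-ps : length ps ≡ suc (suc (suc n)))
  (L : V (CompleteMultipartite ps) → List ℕ)
  (A : IsLamAssignment (suc (suc (suc n))) (twoThenOnes (suc n)) (CompleteMultipartite ps) L) where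

  open TwoThenOnesAssignment ps (suc n) length-ps L A

  Usable₁ : V G → ℕ → Set
  Usable₁ v α = α ∈ L v × (c α ≡ zero ⊎ c α ≡ suc zero)

  usable₀⇒₁ : ∀ {v α} → Usable₀ v α → Usable₁ v α
  usable₀⇒₁ (α∈L , cα) = α∈L , inj₁ cα

  spare : V G → ℕ
  spare v = proj₁ (single v zero)

  spare-usable : ∀ v → Usable₁ v (spare v)
  spare-usable v = proj₁ (proj₂ (single v zero)) , inj₂ (proj₂ (proj₂ (single v zero)))

  usable₀-≢-spare : ∀ {v α} → Usable₀ v α → ∀ b → α ≢ spare b
  usable₀-≢-spare (_ , cα) b e with trans (sym cα) (trans (cong c e) (proj₂ (proj₂ (single b zero))))
  ... | ()

  colour-three-parts : ∀ i j l → i ≢ j → i ≢ l → j ≢ l → (colᵢ colⱼ colₗ : V G → ℕ) →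
    (∀ v → proj₁ v ≡ i → Usable₁ v (colᵢ v)) → (∀ v → proj₁ v ≡ j → Usable₁ v (colⱼ v)) →
    (∀ v → proj₁ v ≡ l → Usable₁ v (colₗ v)) →
    (∀ a b → proj₁ a ≡ i → proj₁ b ≡ j → colᵢ a ≢ colⱼ b) →
    (∀ a b → proj₁ a ≡ i → proj₁ b ≡ l → colᵢ a ≢ colₗ b) →
    (∀ a b → proj₁ a ≡ j → proj₁ b ≡ l → colⱼ a ≢ colₗ b) → IsLColorable G L
  colour-three-parts i j l i≢j i≢l j≢l colᵢ colⱼ colₗ okᵢ okⱼ okₗ apartᵢⱼ apartᵢₗ apartⱼₗ =
    colour-from-special-parts Sp (λ x → (x ≟ᶠ i) ⊎-dec (x ≟ᶠ j) ⊎-dec (x ≟ᶠ l)) g g-inj χ χ∈L χ-class χ-proper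
    where
    Sp : Fin (length ps) → Set
    Sp x = x ≡ i ⊎ x ≡ j ⊎ x ≡ l
    i≢ : ∀ x → ¬ Sp x → cast length-ps i ≢ cast length-ps x
    i≢ x ¬sp = cast-≢ (λ e → ¬sp (inj₁ (sym e)))
    j≢ : ∀ x → ¬ Sp x → cast length-ps j ≢ cast length-ps x
    j≢ x ¬sp = cast-≢ (λ e → ¬sp (inj₂ (inj₁ (sym e))))
    l≢ : ∀ x → ¬ Sp x → cast length-ps l ≢ cast length-ps x
    l≢ x ¬sp = cast-≢ (λ e → ¬sp (inj₂ (inj₂ (sym e))))
    g : ∀ x → ¬ Sp x → Fin (length (replicate (suc n) 1))
    g x ¬sp = suc (cast (sym (length-replicate n))
      (punchOut₃ (cast-≢ i≢j) (cast-≢ i≢l) (cast-≢ j≢l) (i≢ x ¬sp) (j≢ x ¬sp) (l≢ x ¬sp)))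
    g-inj : ∀ x y p q → g x p ≡ g y q → x ≡ y
    g-inj x y p q e = cast-injective length-ps (punchOut₃-injective (cast-≢ i≢j) (cast-≢ i≢l) (cast-≢ j≢l)
      (i≢ x p) (j≢ x p) (l≢ x p) (i≢ y q) (j≢ y q) (l≢ y q)
      (cast-injective (sym (length-replicate n)) (Fin.suc-injective e)))
    χ : ∀ v → Sp (proj₁ v) → ℕ
    χ v (inj₁ _) = colᵢ v
    χ v (inj₂ (inj₁ _)) = colⱼ v
    χ v (inj₂ (inj₂ _)) = colₗ v
    χ-usable : ∀ v p → Usable₁ v (χ v p)
    χ-usable v (inj₁ e) = okᵢ v e
    χ-usable v (inj₂ (inj₁ e)) = okⱼ v e
    χ-usable v (inj₂ (inj₂ e)) = okₗ v e
    χ∈L : ∀ v p → χ v p ∈ L v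
    χ∈L v p = proj₁ (χ-usable v p)
    χ-class : ∀ v p y q → c (χ v p) ≢ suc (g y q)
    χ-class v p y q e with proj₂ (χ-usable v p)
    ... | inj₁ c₀ with trans (sym c₀) e
    ... | ()
    χ-class v p y q e | inj₂ c₁ with trans (sym c₁) e
    ... | ()
    χ-proper : ∀ u v p q → proj₁ u ≢ proj₁ v → χ u p ≢ χ v q
    χ-proper u v (inj₁ eu) (inj₁ ev) u≢v = ⊥-elim (u≢v (trans eu (sym ev)))
    χ-proper u v (inj₂ (inj₁ eu)) (inj₂ (inj₁ ev)) u≢v = ⊥-elim (u≢v (trans eu (sym ev)))
    χ-proper u v (inj₂ (inj₂ eu)) (inj₂ (inj₂ ev)) u≢v = ⊥-elim (u≢v (trans eu (sym ev)))
    χ-proper u v (inj₁ eu) (inj₂ (inj₁ ev)) _ = apartᵢⱼ u v eu ev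
    χ-proper u v (inj₁ eu) (inj₂ (inj₂ ev)) _ = apartᵢₗ u v eu ev
    χ-proper u v (inj₂ (inj₁ eu)) (inj₂ (inj₂ ev)) _ = apartⱼₗ u v eu ev
    χ-proper u v (inj₂ (inj₁ eu)) (inj₁ ev) _ = ≢-sym (apartᵢⱼ v u ev eu)
    χ-proper u v (inj₂ (inj₂ eu)) (inj₁ ev) _ = ≢-sym (apartᵢₗ v u ev eu)
    χ-proper u v (inj₂ (inj₂ eu)) (inj₂ (inj₁ ev)) _ = ≢-sym (apartⱼₗ v u ev eu)

  Within : V G → V G → Set
  Within v a = X v ∈P a × Y v ∈P a

  within? : ∀ v a → Dec (Within v a)
  within? v a = (X v ∈₂? X a , Y a) ×-dec (Y v ∈₂? X a , Y a)

  within⇒∈P : ∀ {v a z} → Within v a → z ∈P v → z ∈P a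
  within⇒∈P (p , _) (inj₁ refl) = p
  within⇒∈P (_ , q) (inj₂ refl) = q

  Meets : V G → V G → Set
  Meets v a = X v ∈P a ⊎ Y v ∈P a

  meets : ∀ {v a z} → z ∈P v → z ∈P a → Meets v a
  meets (inj₁ refl) p = inj₁ p
  meets (inj₂ refl) p = inj₂ p

  inside outside : V G → V G → ℕ
  inside a v with X v ∈₂? X a , Y a
  ... | yes _ = X v
  ... | no _ = Y v
  outside a v with X v ∈₂? X a , Y a
  ... | yes _ = Y v
  ... | no _ = X v

  inside-ok : ∀ a v → Meets v a → Usable₀ v (inside a v) × inside a v ∈P a
  inside-ok a v m with X v ∈₂? X a , Y a | m
  ... | yes p | _ = X-usable v , p
  ... | no _ | inj₂ q = Y-usable v , q
  ... | no ¬p | inj₁ p = ⊥-elim (¬p p)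

  outside-ok : ∀ a v → ¬ Within v a → Usable₀ v (outside a v) × ¬ outside a v ∈P a
  outside-ok a v ¬w with X v ∈₂? X a , Y a
  ... | yes p = Y-usable v , λ q → ¬w (p , q)
  ... | no ¬p = X-usable v , ¬p

  module SizesTwoFourFive (i j l : Fin (length ps)) (i≢j : i ≢ j) (i≢l : i ≢ l) (j≢l : j ≢ l)
    (size-i : lookup ps i ≡ 2) (j≤4 : lookup ps j ≤ 4) (l≤5 : lookup ps l ≤ 5) where

    open PartOfSize2 i size-i

    colour-with-pair-and-spare : ∀ j′ l′ → i ≢ j′ → i ≢ l′ → j′ ≢ l′ → ∀ {x y} → Usable₀ a₁ x → Usable₀ a₂ y →
      (col : V G → ℕ) → (∀ v → proj₁ v ≡ j′ → Usable₀ v (col v) × ¬ col v ∈₂ x , y) → IsLColorable G L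
    colour-with-pair-and-spare j′ l′ i≢j′ i≢l′ j′≢l′ ux uy col ok =
      colour-three-parts i j′ l′ i≢j′ i≢l′ j′≢l′ (paint _ _) col spare
        (λ v p → usable₀⇒₁ (paint-usable ux uy v p)) (λ v p → usable₀⇒₁ (proj₁ (ok v p)))
        (λ v _ → spare-usable v)
        (paint-apart j′ col (λ v p → proj₂ (ok v p)))
        (λ a b p _ → usable₀-≢-spare (paint-usable ux uy a p) b)
        (λ a b p _ → usable₀-≢-spare (proj₁ (ok a p)) b)

    separate-by : ∀ a → (∀ v → proj₁ v ≡ j → Meets v a) → (∀ r → ¬ Within (l , r) a) → IsLColorable G L
    separate-by a j-meets l-outside = colour-three-parts i j l i≢j i≢l j≢l spare (inside a) (outside a)
      (λ v _ → spare-usable v) (λ v p → usable₀⇒₁ (proj₁ (inside-ok a v (j-meets v p))))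
      (λ v p → usable₀⇒₁ (proj₁ (outside-l v p)))
      (λ x b _ p e → usable₀-≢-spare (proj₁ (inside-ok a b (j-meets b p))) x (sym e))
      (λ x b _ p e → usable₀-≢-spare (proj₁ (outside-l b p)) x (sym e))
      (λ x b p q e → proj₂ (outside-l b q) (subst (_∈P a) e (proj₂ (inside-ok a x (j-meets x p)))))
      where
      outside-l : ∀ v → proj₁ v ≡ l → Usable₀ v (outside a v) × ¬ outside a v ∈P a
      outside-l (_ , r) refl = outside-ok a _ (l-outside r)

    every-j-vertex-blocks : ¬ Shared a₁ a₂ → Blocker j → ∀ v → proj₁ v ≡ j → ∃[ κ ] Blocked v (u κ) (w κ)
    every-j-vertex-blocks disjoint h (_ , r) refl with Fin.any? (λ κ → blocked? (j , r) (u κ) (w κ))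
    ... | yes found = found
    ... | no none = ⊥-elim (no-injection-missing-one (λ κ → proj₁ (h κ)) (blocker-injective disjoint j h) r
      (λ κ e → none (κ , subst (λ r′ → Blocked (j , r′) (u κ) (w κ)) e (proj₂ (h κ)))) j≤4)

    ¬within-both : ¬ Shared a₁ a₂ → Blocker l → ∀ r₁ r₂ → Within (l , r₁) a₁ → Within (l , r₂) a₂ → ⊥
    ¬within-both disjoint h r₁ r₂ w₁ w₂ = no-injection-missing-two (λ κ → proj₁ (h κ))
      (blocker-injective disjoint l h) r₁ r₂ r₁≢r₂ misses₁ misses₂ l≤5
      where
      r₁≢r₂ : r₁ ≢ r₂
      r₁≢r₂ refl = disjoint (X (l , r₁) , proj₁ w₁ , proj₁ w₂)
      blocks : ∀ {κ r} → proj₁ (h κ) ≡ r → Blocked (l , r) (u κ) (w κ)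
      blocks {κ} e = subst (λ r → Blocked (l , r) (u κ) (w κ)) e (proj₂ (h κ))
      misses₁ : ∀ κ → proj₁ (h κ) ≢ r₁
      misses₁ κ e = disjoint (w κ , within⇒∈P w₁ (proj₂ (blocked⇒∈P (blocks e))) , w∈P κ)
      misses₂ : ∀ κ → proj₁ (h κ) ≢ r₂
      misses₂ κ e = disjoint (u κ , u∈P κ , within⇒∈P w₂ (proj₁ (blocked⇒∈P (blocks e))))

    -- Part j has at most four vertices and four choices to block, so each of its vertices blocks
    -- one and meets the pairs of both a₁ and a₂.  If no pair in part l lies inside the pair of a₁
    -- (or of a₂), part j is coloured inside and part l outside that pair.  Otherwise the two
    -- vertices of l whose pairs do lie inside block nothing, leaving at most three vertices of l
    -- to block four choices.
    colourable-when-blocked : ¬ Shared a₁ a₂ → Blocker j → Blocker l → IsLColorable G L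
    colourable-when-blocked disjoint hⱼ hₗ
      with Fin.any? (λ r → within? (l , r) a₁) | Fin.any? (λ r → within? (l , r) a₂)
    ... | no none₁ | _ = separate-by a₁
      (λ v p → let (κ , b) = every-j-vertex-blocks disjoint hⱼ v p in meets (proj₁ (blocked⇒∈P b)) (u∈P κ))
      (λ r w → none₁ (r , w))
    ... | _ | no none₂ = separate-by a₂
      (λ v p → let (κ , b) = every-j-vertex-blocks disjoint hⱼ v p in meets (proj₂ (blocked⇒∈P b)) (w∈P κ))
      (λ r w → none₂ (r , w))
    ... | yes (r₁ , w₁) | yes (r₂ , w₂) = ⊥-elim (¬within-both disjoint hₗ r₁ r₂ w₁ w₂)

    colourable : IsLColorable G L
    colourable with shared? a₁ a₂
    ... | yes (z , z∈₁ , z∈₂) = colour-with-pair-and-spare j l i≢j i≢l j≢l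
      (∈P⇒usable a₁ z∈₁) (∈P⇒usable a₂ z∈₂) (λ v → avoid v z z) (λ v _ → avoid-shared z v)
    ... | no disjoint with free? j | free? l
    ... | yes (κ , free) | _ = colour-with-pair-and-spare j l i≢j i≢l j≢l
      (∈P⇒usable a₁ (u∈P κ)) (∈P⇒usable a₂ (w∈P κ)) (λ v → avoid v (u κ) (w κ)) (avoid-free j κ free)
    ... | no _ | yes (κ , free) = colour-with-pair-and-spare l j i≢l i≢j (≢-sym j≢l)
      (∈P⇒usable a₁ (u∈P κ)) (∈P⇒usable a₂ (w∈P κ)) (λ v → avoid v (u κ) (w κ)) (avoid-free l κ free)
    ... | no none-j | no none-l = colourable-when-blocked disjoint (blocker j none-j) (blocker l none-l)

sum-replicate-1 : ∀ n → sum (replicate n 1) ≡ n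
sum-replicate-1 zero = refl
sum-replicate-1 (suc n) = cong suc (sum-replicate-1 n)

twoThenOnes-isPartition : ∀ n → IsPartition (suc (suc n)) (twoThenOnes n)
twoThenOnes-isPartition n = (s≤s z≤n ∷ replicate⁺ n (s≤s z≤n)) , cong (λ m → suc (suc m)) (sum-replicate-1 n)

twoThenOnes-≁-ones : ∀ n → ¬ (twoThenOnes n ↭ replicate (suc (suc n)) 1)
twoThenOnes-≁-ones n p with All.lookup (replicate⁺ {P = _≡ 1} (suc (suc n)) refl) (∈-resp-↭ p (here refl))
... | ()

strictly⇒¬twoThenOnes-choosable : ∀ n G → IsStrictlyColorable (suc (suc n)) G →
  ¬ IsLamChoosable (suc (suc n)) (twoThenOnes n) G
strictly⇒¬twoThenOnes-choosable n G (_ , only-ones) choosable =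
  twoThenOnes-≁-ones n (only-ones _ (twoThenOnes-isPartition n) choosable)

≡2-from-bounds : ∀ {m} → 1 ≤ m → m ≢ 1 → ¬ 3 ≤ m → m ≡ 2
≡2-from-bounds {suc zero} _ m≢1 _ = ⊥-elim (m≢1 refl)
≡2-from-bounds {suc (suc zero)} _ _ _ = refl
≡2-from-bounds {suc (suc (suc m))} _ _ m≱3 = ⊥-elim (m≱3 (s≤s (s≤s (s≤s z≤n))))

module Classification (n : ℕ) (ps : List ℕ) (length-ps : length ps ≡ suc (suc (suc n)))
  (positive : All (1 ≤_) ps) where

  k : ℕ
  k = suc (suc (suc n))

  G : Graph
  G = CompleteMultipartite ps

  size : Fin (length ps) → ℕ
  size = lookup ps

  HasCriticalSubgraph : Set
  HasCriticalSubgraph = IsSubgraph (CompleteMultipartite (replicate k 3)) G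
    ⊎ (IsSubgraph (CompleteMultipartite (2 ∷ 4 ∷ replicate (k ∸ 2) 6)) G
    ⊎ IsSubgraph (CompleteMultipartite (2 ∷ replicate (k ∸ 1) 5)) G)

  TwoThenOnesChoosable : Set
  TwoThenOnesChoosable = IsLamChoosable k (twoThenOnes (suc n)) G

  Sizes-2-≤3 : Set
  Sizes-2-≤3 = ∃[ i ] ∃[ j ] i ≢ j × size i ≡ 2 × size j ≤ 3

  Sizes-2-≤4-≤5 : Set
  Sizes-2-≤4-≤5 = ∃[ i ] ∃[ j ] ∃[ l ] i ≢ j × i ≢ l × j ≢ l × size i ≡ 2 × size j ≤ 4 × size l ≤ 5

  another-part : ∀ i → ∃[ j ] i ≢ j
  another-part i with i ≟ᶠ cast (sym length-ps) zero
  ... | no i≢0 = _ , i≢0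
  ... | yes refl = cast (sym length-ps) (suc zero) , λ e → case (cast-injective (sym length-ps) e)
    where
    case : zero ≢ suc zero
    case ()

  choosable-with-size-1 : ∀ i → size i ≡ 1 → TwoThenOnesChoosable
  choosable-with-size-1 i size-i L A =
    TwoThenOnesAssignment.colourable-with-size-1 ps (suc n) length-ps L A i _ (proj₂ (another-part i)) size-i

  choosable-with-sizes-2-≤3 : Sizes-2-≤3 → TwoThenOnesChoosable
  choosable-with-sizes-2-≤3 (i , j , i≢j , size-i , j≤3) L A =
    TwoThenOnesAssignment.PartOfSize2.colourable-with-≤3 ps (suc n) length-ps L A i size-i j i≢j j≤3

  choosable-with-sizes-2-≤4-≤5 : Sizes-2-≤4-≤5 → TwoThenOnesChoosable
  choosable-with-sizes-2-≤4-≤5 (i , j , l , i≢j , i≢l , j≢l , size-i , j≤4 , l≤5) L A =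
    TwoThenOnesAssignment₃.SizesTwoFourFive.colourable ps n length-ps L A i j l i≢j i≢l j≢l size-i j≤4 l≤5

  critical-with-size-2 : ¬ Sizes-2-≤3 → ¬ Sizes-2-≤4-≤5 → ∀ i → size i ≡ 2 → HasCriticalSubgraph
  critical-with-size-2 no-2-3 no-2-4-5 i size-i with Fin.all? (λ j → (j ≟ᶠ i) ⊎-dec (5 ≤? size j))
  ... | yes all = inj₂ (inj₂ (K2,5*-⊆ n ps length-ps i (ℕ.≤-reflexive (sym size-i)) large))
    where
    large : ∀ j → j ≢ i → 5 ≤ size j
    large j j≢i with all j
    ... | inj₁ j≡i = ⊥-elim (j≢i j≡i)
    ... | inj₂ 5≤j = 5≤j
  ... | no ¬all = inj₂ (inj₁ (K2,4,6*-⊆ n ps length-ps i j i≢j (ℕ.≤-reflexive (sym size-i)) 4≤j large))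
    where
    counterexample = Fin.¬∀⟶∃¬ _ _ (λ j → (j ≟ᶠ i) ⊎-dec (5 ≤? size j)) ¬all
    j : Fin (length ps)
    j = proj₁ counterexample
    i≢j : i ≢ j
    i≢j e = proj₂ counterexample (inj₁ (sym e))
    j≤4 : size j ≤ 4
    j≤4 = ℕ.≤-pred (ℕ.≰⇒> (λ 5≤j → proj₂ counterexample (inj₂ 5≤j)))
    4≤j : 4 ≤ size j
    4≤j with 4 ≤? size j
    ... | yes 4≤j = 4≤j
    ... | no 4≰j = ⊥-elim (no-2-3 (i , j , i≢j , size-i , ℕ.≤-pred (ℕ.≰⇒> 4≰j)))
    large : ∀ l → l ≢ i → l ≢ j → 6 ≤ size l
    large l l≢i l≢j with 6 ≤? size l
    ... | yes 6≤l = 6≤l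
    ... | no 6≰l =
      ⊥-elim (no-2-4-5 (i , j , l , i≢j , ≢-sym l≢i , ≢-sym l≢j , size-i , j≤4 , ℕ.≤-pred (ℕ.≰⇒> 6≰l)))

  choosable-or-critical : TwoThenOnesChoosable ⊎ HasCriticalSubgraph
  choosable-or-critical with Fin.any? (λ i → size i ≟ℕ 1)
  ... | yes (i , size-i) = inj₁ (choosable-with-size-1 i size-i)
  ... | no no-1 with Fin.any? (λ i → Fin.any? λ j → ¬? (i ≟ᶠ j) ×-dec size i ≟ℕ 2 ×-dec size j ≤? 3)
  ... | yes found = inj₁ (choosable-with-sizes-2-≤3 found)
  ... | no no-2-3 with Fin.any? (λ i → Fin.any? λ j → Fin.any? λ l →
          ¬? (i ≟ᶠ j) ×-dec ¬? (i ≟ᶠ l) ×-dec ¬? (j ≟ᶠ l) ×-dec size i ≟ℕ 2 ×-dec size j ≤? 4 ×-dec size l ≤? 5)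
  ... | yes found = inj₁ (choosable-with-sizes-2-≤4-≤5 found)
  ... | no no-2-4-5 with Fin.all? (λ i → 3 ≤? size i)
  ... | yes all≥3 = inj₂ (inj₁ (K3*k-⊆ k ps length-ps all≥3))
  ... | no ¬all≥3 = inj₂ (critical-with-size-2 no-2-3 no-2-4-5 i
      (≡2-from-bounds (lookup-All positive i) (λ e → no-1 (i , e)) (proj₂ counterexample)))
    where
    counterexample = Fin.¬∀⟶∃¬ _ _ (λ i → 3 ≤? size i) ¬all≥3
    i = proj₁ counterexample

  strictly⇒critical : IsStrictlyColorable k G → HasCriticalSubgraph
  strictly⇒critical strictly with choosable-or-critical
  ... | inj₁ choosable = ⊥-elim (strictly⇒¬twoThenOnes-choosable (suc n) G strictly choosable)
  ... | inj₂ critical = critical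

concatᶠ : ∀ t → (Fin t → List ℕ) → List ℕ
concatᶠ zero f = []
concatᶠ (suc t) f = f zero ++ concatᶠ t (λ q → f (suc q))

sumᶠ : ∀ t → (Fin t → ℕ) → ℕ
sumᶠ zero f = 0
sumᶠ (suc t) f = f zero + sumᶠ t (λ q → f (suc q))

length-concatᶠ : ∀ t f → length (concatᶠ t f) ≡ sumᶠ t (λ q → length (f q))
length-concatᶠ zero f = refl
length-concatᶠ (suc t) f = trans (length-++ (f zero)) (cong (length (f zero) +_) (length-concatᶠ t _))

∈-concatᶠ⁻ : ∀ {x} t f → x ∈ concatᶠ t f → ∃[ q ] x ∈ f q
∈-concatᶠ⁻ (suc t) f x∈ with ∈-++⁻ (f zero) x∈
... | inj₁ x∈f₀ = zero , x∈f₀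
... | inj₂ x∈rest = let (q , x∈fq) = ∈-concatᶠ⁻ t _ x∈rest in suc q , x∈fq

concatᶠ-unique : ∀ t f → (∀ q → Unique (f q)) → (∀ q q′ x → x ∈ f q → x ∈ f q′ → q ≡ q′) →
  Unique (concatᶠ t f)
concatᶠ-unique zero f _ _ = []
concatᶠ-unique (suc t) f unique disjoint = Unique.++⁺ (unique zero)
  (concatᶠ-unique t _ (λ q → unique (suc q)) (λ q q′ x x∈ x∈′ → Fin.suc-injective (disjoint _ _ x x∈ x∈′)))
  λ (x∈f₀ , x∈rest) → let (q , x∈fq) = ∈-concatᶠ⁻ t _ x∈rest in
    zero≢suc (disjoint zero (suc q) _ x∈f₀ x∈fq)
  where
  zero≢suc : ∀ {q : Fin t} → zero ≢ suc q
  zero≢suc ()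

countIn-concatᶠ : ∀ {s} (c : ℕ → Fin s) i t f → countIn c i (concatᶠ t f) ≡ sumᶠ t (λ q → countIn c i (f q))
countIn-concatᶠ c i zero f = refl
countIn-concatᶠ c i (suc t) f =
  trans (countIn-++ c i (f zero) _) (cong (countIn c i (f zero) +_) (countIn-concatᶠ c i t _))

sumᶠ-cong : ∀ t (f g : Fin t → ℕ) → (∀ q → f q ≡ g q) → sumᶠ t f ≡ sumᶠ t g
sumᶠ-cong zero f g _ = refl
sumᶠ-cong (suc t) f g f≗g = cong₂ _+_ (f≗g zero) (sumᶠ-cong t _ _ λ q → f≗g (suc q))

sumᶠ-update : ∀ t (f g : Fin t → ℕ) p d → f p + d ≡ g p → (∀ q → q ≢ p → f q ≡ g q) →
  sumᶠ t f + d ≡ sumᶠ t g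
sumᶠ-update (suc t) f g zero d fp+d≡gp elsewhere = begin
  f zero + sumᶠ t (f ∘ suc) + d   ≡⟨ ℕ.+-assoc (f zero) _ d ⟩
  f zero + (sumᶠ t (f ∘ suc) + d) ≡⟨ cong (f zero +_) (ℕ.+-comm (sumᶠ t _) d) ⟩
  f zero + (d + sumᶠ t (f ∘ suc)) ≡⟨ ℕ.+-assoc (f zero) d _ ⟨
  f zero + d + sumᶠ t (f ∘ suc)   ≡⟨ cong₂ _+_ fp+d≡gp (sumᶠ-cong t _ _ λ q → elsewhere (suc q) λ ()) ⟩
  g zero + sumᶠ t (g ∘ suc)       ∎
  where open ≡-Reasoning
sumᶠ-update (suc t) f g (suc p) d fp+d≡gp elsewhere = begin
  f zero + sumᶠ t (f ∘ suc) + d   ≡⟨ ℕ.+-assoc (f zero) _ d ⟩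
  f zero + (sumᶠ t (f ∘ suc) + d) ≡⟨ cong₂ _+_ (elsewhere zero λ ())
                                       (sumᶠ-update t _ _ p d fp+d≡gp
                                         λ q q≢p → elsewhere (suc q) (q≢p ∘ Fin.suc-injective)) ⟩
  g zero + sumᶠ t (g ∘ suc)       ∎
  where open ≡-Reasoning

sumᶠ-zero : ∀ t (f : Fin t → ℕ) → (∀ q → f q ≡ 0) → sumᶠ t f ≡ 0
sumᶠ-zero zero f _ = refl
sumᶠ-zero (suc t) f f≡0 = cong₂ _+_ (f≡0 zero) (sumᶠ-zero t _ λ q → f≡0 (suc q))

sumᶠ-single : ∀ t (f : Fin t → ℕ) i → (∀ q → q ≢ i → f q ≡ 0) → sumᶠ t f ≡ f i
sumᶠ-single (suc t) f zero elsewhere =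
  trans (cong (f zero +_) (sumᶠ-zero t _ λ q → elsewhere (suc q) λ ())) (ℕ.+-identityʳ _)
sumᶠ-single (suc t) f (suc i) elsewhere =
  cong₂ _+_ (elsewhere zero λ ()) (sumᶠ-single t _ i λ q q≢i → elsewhere (suc q) (q≢i ∘ Fin.suc-injective))

sumᶠ-lookup : ∀ (xs : List ℕ) → sumᶠ (length xs) (lookup xs) ≡ sum xs
sumᶠ-lookup [] = refl
sumᶠ-lookup (x ∷ xs) = cong (x +_) (sumᶠ-lookup xs)

-- colour q r is the r-th colour of class q, classes being residues modulo t.  Colours 0 to 3 of
-- class p are reserved for the pairs; the shared colours are the other λ_p - 2 colours of class p
-- and λ_q colours of every other class q.
module PairLists (l₀ : ℕ) (lr : List ℕ) (p : Fin (suc (length lr))) (2≤λp : 2 ≤ lookup (l₀ ∷ lr) p) where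

  lam : List ℕ
  lam = l₀ ∷ lr

  t : ℕ
  t = suc (length lr)

  colour : Fin t → ℕ → ℕ
  colour q r = toℕ q + r * t

  class : ℕ → Fin t
  class x = fromℕ< (m%n<n x t)

  class-colour : ∀ q r → class (colour q r) ≡ q
  class-colour q r = Fin.toℕ-injective (trans (Fin.toℕ-fromℕ< (m%n<n (colour q r) t))
    (trans ([m+kn]%n≡m%n (toℕ q) r t) (m<n⇒m%n≡m (Fin.toℕ<n q))))

  colour-injective : ∀ q r r′ → colour q r ≡ colour q r′ → r ≡ r′
  colour-injective q r r′ e = ℕ.*-cancelʳ-≡ r r′ t (ℕ.+-cancelˡ-≡ (toℕ q) _ _ e)

  block : Fin t → ℕ → ℕ → List ℕ
  block q s zero = []
  block q s (suc m) = colour q s ∷ block q (suc s) m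

  ∈-block⁻ : ∀ {x} q s m → x ∈ block q s m → ∃[ r ] s ≤ r × x ≡ colour q r
  ∈-block⁻ q s (suc m) (here x≡) = s , ℕ.≤-refl , x≡
  ∈-block⁻ q s (suc m) (there x∈) = let (r , s<r , x≡) = ∈-block⁻ q (suc s) m x∈ in r , ℕ.<⇒≤ s<r , x≡

  block-unique : ∀ q s m → Unique (block q s m)
  block-unique q s zero = []
  block-unique q s (suc m) = ¬Any⇒All¬ (block q (suc s) m)
    (λ x∈ → let (r , s<r , x≡) = ∈-block⁻ q (suc s) m x∈ in ℕ.<-irrefl (colour-injective q s r x≡) s<r)
    ∷ block-unique q (suc s) m

  length-block : ∀ q s m → length (block q s m) ≡ m
  length-block q s zero = refl
  length-block q s (suc m) = cong suc (length-block q (suc s) m)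

  class-block : ∀ {x} q s m → x ∈ block q s m → class x ≡ q
  class-block q s m x∈ = let (r , _ , x≡) = ∈-block⁻ q s m x∈ in trans (cong class x≡) (class-colour q r)

  start count : Fin t → ℕ
  start q with q ≟ᶠ p
  ... | yes _ = 4
  ... | no _ = 0
  count q with q ≟ᶠ p
  ... | yes _ = lookup lam p ∸ 2
  ... | no _ = lookup lam q

  start-p : start p ≡ 4
  start-p with p ≟ᶠ p
  ... | yes _ = refl
  ... | no p≢p = ⊥-elim (p≢p refl)

  count-p : count p ≡ lookup lam p ∸ 2
  count-p with p ≟ᶠ p
  ... | yes _ = refl
  ... | no p≢p = ⊥-elim (p≢p refl)

  count-≢p : ∀ q → q ≢ p → count q ≡ lookup lam q
  count-≢p q q≢p with q ≟ᶠ p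
  ... | yes q≡p = ⊥-elim (q≢p q≡p)
  ... | no _ = refl

  blockOf : Fin t → List ℕ
  blockOf q = block q (start q) (count q)

  shared : List ℕ
  shared = concatᶠ t blockOf

  ∈-shared⁻ : ∀ {x} → x ∈ shared → ∃[ q ] x ∈ blockOf q × class x ≡ q
  ∈-shared⁻ x∈ = let (q , x∈q) = ∈-concatᶠ⁻ t blockOf x∈ in q , x∈q , class-block q _ _ x∈q

  shared-unique : Unique shared
  shared-unique = concatᶠ-unique t blockOf (λ q → block-unique q _ _)
    λ q q′ x x∈ x∈′ → trans (sym (class-block q _ _ x∈)) (class-block q′ _ _ x∈′)

  reserved-∉-shared : ∀ a → a < 4 → colour p a ∉ shared
  reserved-∉-shared a a<4 x∈ with ∈-shared⁻ x∈
  ... | q , x∈q , class≡q with trans (sym (class-colour p a)) class≡q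
  ... | refl = let (r , start≤r , a≡) = ∈-block⁻ p (start p) (count p) x∈q in
    ℕ.<-irrefl refl (ℕ.≤-trans a<4 (ℕ.≤-trans (ℕ.≤-reflexive (sym start-p))
      (ℕ.≤-trans start≤r (ℕ.≤-reflexive (sym (colour-injective p a r a≡))))))

  length-shared : length shared + 2 ≡ sum lam
  length-shared = begin
    length shared + 2             ≡⟨ cong (_+ 2) (length-concatᶠ t blockOf) ⟩
    sumᶠ t (length ∘ blockOf) + 2 ≡⟨ cong (_+ 2) (sumᶠ-cong t _ count
                                       λ q → length-block q (start q) (count q)) ⟩
    sumᶠ t count + 2              ≡⟨ sumᶠ-update t count (lookup lam) p 2
                                       (trans (cong (_+ 2) count-p) (ℕ.m∸n+n≡m 2≤λp)) count-≢p ⟩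
    sumᶠ t (lookup lam)           ≡⟨ sumᶠ-lookup lam ⟩
    sum lam                       ∎
    where open ≡-Reasoning

  countIn-shared : ∀ i → countIn class i shared ≡ count i
  countIn-shared i = trans (countIn-concatᶠ class i t blockOf) (trans (sumᶠ-single t _ i
    (λ q q≢i → proj₂ (countIn-homogeneous class i q (blockOf q) (λ x x∈ → class-block q _ _ x∈)) q≢i))
    (trans (proj₁ (countIn-homogeneous class i i (blockOf i) (λ x x∈ → class-block i _ _ x∈)) refl)
      (length-block i _ _)))

  pairList : Fin 4 → Fin 4 → List ℕ
  pairList a b = colour p (toℕ a) ∷ colour p (toℕ b) ∷ shared

  pairList-unique : ∀ a b → a ≢ b → Unique (pairList a b)
  pairList-unique a b a≢b =
    ((λ e → a≢b (Fin.toℕ-injective (colour-injective p _ _ e)))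
      ∷ ¬Any⇒All¬ shared (reserved-∉-shared (toℕ a) (Fin.toℕ<n a)))
    ∷ (¬Any⇒All¬ shared (reserved-∉-shared (toℕ b) (Fin.toℕ<n b)) ∷ shared-unique)

  length-pairList : ∀ a b → length (pairList a b) ≡ sum lam
  length-pairList a b = trans (ℕ.+-comm 2 (length shared)) length-shared

  countIn-pairList : ∀ a b i → countIn class i (pairList a b) ≡ lookup lam i
  countIn-pairList a b i with countIn-homogeneous class i p (colour p (toℕ a) ∷ colour p (toℕ b) ∷ []) reserved-class
    where
    reserved-class : ∀ x → x ∈ colour p (toℕ a) ∷ colour p (toℕ b) ∷ [] → class x ≡ p
    reserved-class x (here refl) = class-colour p (toℕ a)
    reserved-class x (there (here refl)) = class-colour p (toℕ b)
  ... | (in-p , not-in-p) with p ≟ᶠ i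
  ... | yes refl = trans (countIn-++ class p (colour p (toℕ a) ∷ colour p (toℕ b) ∷ []) shared)
    (trans (cong₂ _+_ (in-p refl) (trans (countIn-shared p) count-p)) (trans (ℕ.+-comm 2 _) (ℕ.m∸n+n≡m 2≤λp)))
  ... | no p≢i = trans (countIn-++ class i (colour p (toℕ a) ∷ colour p (toℕ b) ∷ []) shared)
    (trans (cong₂ _+_ (not-in-p p≢i) (countIn-shared i)) (count-≢p i (≢-sym p≢i)))

Pair : Set
Pair = Fin 4 × Fin 4

_∈ᵖ_ : Fin 4 → Pair → Set
a ∈ᵖ (x , y) = a ≡ x ⊎ a ≡ y

PatternsClash : ∀ {s s′} → (Fin s → Pair) → (Fin s′ → Pair) → Set
PatternsClash {s} {s′} P P′ = (X : Fin s → Fin 4) (Y : Fin s′ → Fin 4) →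
  (∀ r → X r ∈ᵖ P r) → (∀ r → Y r ∈ᵖ P′ r) → ∃[ r ] ∃[ r′ ] X r ≡ Y r′

Distinct : ∀ {s} → (Fin s → Pair) → Set
Distinct P = ∀ r → proj₁ (P r) ≢ proj₂ (P r)

distinct? : ∀ {s} (P : Fin s → Pair) → Dec (Distinct P)
distinct? P = Fin.all? λ r → ¬? (proj₁ (P r) ≟ᶠ proj₂ (P r))

record PairPattern (hs : List ℕ) : Set where
  field
    pairs    : ∀ q → Fin (lookup hs q) → Pair
    distinct : ∀ q → Distinct (pairs q)
    clash    : ∀ q q′ → q ≢ q′ → PatternsClash (pairs q) (pairs q′)

vertex-≟ : ∀ ps (u v : V (CompleteMultipartite ps)) → Dec (u ≡ v)
vertex-≟ ps (i , r) (i′ , r′) with i ≟ᶠ i′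
... | no i≢i′ = no λ e → i≢i′ (cong proj₁ e)
... | yes refl with r ≟ᶠ r′
... | yes refl = yes refl
... | no r≢r′ = no λ e → r≢r′ (snd-≡ e)
  where
  snd-≡ : ∀ {a b} → _≡_ {A = V (CompleteMultipartite ps)} (i , a) (i , b) → a ≡ b
  snd-≡ refl = refl

module NonChoosable (hs ps : List ℕ) (k : ℕ) (length-hs : length hs ≡ k)
  (H⊆G : IsSubgraph (CompleteMultipartite hs) (CompleteMultipartite ps)) (P : PairPattern hs)
  (l₀ : ℕ) (lr : List ℕ) (p : Fin (suc (length lr))) (2≤λp : 2 ≤ lookup (l₀ ∷ lr) p)
  (sum-lam : sum (l₀ ∷ lr) ≡ k) where

  open PairLists l₀ lr p 2≤λp
  open PairPattern P

  H G : Graph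
  H = CompleteMultipartite hs
  G = CompleteMultipartite ps

  f : V H → V G
  f = proj₁ H⊆G

  preimage? : ∀ w → Dec (∃[ u ] f u ≡ w)
  preimage? w with Fin.any? (λ q → Fin.any? (λ r → vertex-≟ ps (f (q , r)) w))
  ... | yes (q , r , e) = yes ((q , r) , e)
  ... | no none = no λ { ((q , r) , e) → none (q , r , e) }

  pairOf : ∀ w → Dec (∃[ u ] f u ≡ w) → Pair
  pairOf w (yes ((q , r) , _)) = pairs q r
  pairOf w (no _) = zero , suc zero

  pairOf-distinct : ∀ w d → proj₁ (pairOf w d) ≢ proj₂ (pairOf w d)
  pairOf-distinct w (yes ((q , r) , _)) = distinct q r
  pairOf-distinct w (no _) ()

  colourPair : V G → Pair
  colourPair w = pairOf w (preimage? w)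

  L : V G → List ℕ
  L w = pairList (proj₁ (colourPair w)) (proj₂ (colourPair w))

  L∘f : ∀ q r → L (f (q , r)) ≡ pairList (proj₁ (pairs q r)) (proj₂ (pairs q r))
  L∘f q r with preimage? (f (q , r))
  ... | yes (u , e) =
    cong (λ { (q , r) → pairList (proj₁ (pairs q r)) (proj₂ (pairs q r)) }) (proj₁ (proj₂ H⊆G) e)
  ... | no none = ⊥-elim (none ((q , r) , refl))

  L-isLamAssignment : IsLamAssignment k (l₀ ∷ lr) G L
  L-isLamAssignment =
    (λ w → pairList-unique (proj₁ (colourPair w)) (proj₂ (colourPair w)) (pairOf-distinct w (preimage? w)) ,
           trans (length-pairList (proj₁ (colourPair w)) (proj₂ (colourPair w))) sum-lam) ,
    class , λ w → countIn-pairList (proj₁ (colourPair w)) (proj₂ (colourPair w))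

  reserved-colours : ∀ {x} a b → x ∈ pairList a b → x ∉ shared → ∃[ z ] x ≡ colour p (toℕ z) × z ∈ᵖ (a , b)
  reserved-colours a b (here e) _ = a , e , inj₁ refl
  reserved-colours a b (there (here e)) _ = b , e , inj₂ refl
  reserved-colours a b (there (there x∈)) x∉ = ⊥-elim (x∉ x∈)

  -- Label each part of H by a shared colour used on it, or by the unused reserved colour
  -- colour p 0.  Distinct parts get distinct labels (two parts without shared colours clash),
  -- but there are only k - 1 labels.
  ¬colourable : ¬ IsLColorable G L
  ¬colourable (φ , φ∈L , φ-proper) = no-injection-into-smaller fewer-labels index index-injective
    where
    ψ : V H → ℕ
    ψ u = φ (f u)
    ψ∈L : ∀ q r → ψ (q , r) ∈ pairList (proj₁ (pairs q r)) (proj₂ (pairs q r))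
    ψ∈L q r = subst (ψ (q , r) ∈_) (L∘f q r) (φ∈L (f (q , r)))
    ψ-proper : ∀ u v → proj₁ u ≢ proj₁ v → ψ u ≢ ψ v
    ψ-proper u v u≢v = φ-proper (f u) (f v) (proj₂ (proj₂ H⊆G) u v u≢v)
    UsesShared : Fin (length hs) → Set
    UsesShared q = ∃[ r ] ψ (q , r) ∈ shared
    labelOf : ∀ q → Dec (UsesShared q) → ∃[ x ] x ∈ colour p 0 ∷ shared
    labelOf q (yes (r , ψ∈)) = ψ (q , r) , there ψ∈
    labelOf q (no _) = colour p 0 , here refl
    usesShared? : ∀ q → Dec (UsesShared q)
    usesShared? q = Fin.any? λ r → ψ (q , r) ∈? shared
    label : ∀ q → ∃[ x ] x ∈ colour p 0 ∷ shared
    label q = labelOf q (usesShared? q)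
    index : Fin (length hs) → Fin (length (colour p 0 ∷ shared))
    index q = Any.index (proj₂ (label q))
    reserved-only : ∀ q → ¬ UsesShared q → ∀ r → ∃[ z ] ψ (q , r) ≡ colour p (toℕ z) × z ∈ᵖ pairs q r
    reserved-only q unused r = reserved-colours _ _ (ψ∈L q r) (λ ψ∈ → unused (r , ψ∈))
    labels-distinct : ∀ q q′ → q ≢ q′ → ∀ d d′ → proj₁ (labelOf q d) ≢ proj₁ (labelOf q′ d′)
    labels-distinct q q′ q≢q′ (yes (r , _)) (yes (r′ , _)) e = ψ-proper (q , r) (q′ , r′) q≢q′ e
    labels-distinct q q′ _ (yes (r , ψ∈)) (no _) e = reserved-∉-shared 0 (s≤s z≤n) (subst (_∈ shared) e ψ∈)
    labels-distinct q q′ _ (no _) (yes (r′ , ψ∈)) e = reserved-∉-shared 0 (s≤s z≤n) (subst (_∈ shared) (sym e) ψ∈)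
    labels-distinct q q′ q≢q′ (no unused) (no unused′) _ =
      let X = λ r → proj₁ (reserved-only q unused r)
          Y = λ r′ → proj₁ (reserved-only q′ unused′ r′)
          (r , r′ , Xr≡Yr′) = clash q q′ q≢q′ X Y
            (λ r → proj₂ (proj₂ (reserved-only q unused r)))
            (λ r′ → proj₂ (proj₂ (reserved-only q′ unused′ r′)))
      in ψ-proper (q , r) (q′ , r′) q≢q′ (trans (proj₁ (proj₂ (reserved-only q unused r)))
           (trans (cong (colour p ∘ toℕ) Xr≡Yr′) (sym (proj₁ (proj₂ (reserved-only q′ unused′ r′))))))
    index-injective : Injective _≡_ _≡_ index
    index-injective {q} {q′} e with q ≟ᶠ q′
    ... | yes q≡q′ = q≡q′
    ... | no q≢q′ = ⊥-elim (labels-distinct q q′ q≢q′ (usesShared? q) (usesShared? q′)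
      (trans (lookup-index (proj₂ (label q)))
        (trans (cong (lookup (colour p 0 ∷ shared)) e) (sym (lookup-index (proj₂ (label q′)))))))
    fewer-labels : length (colour p 0 ∷ shared) < length hs
    fewer-labels = ℕ.≤-reflexive
      (trans (ℕ.+-comm 2 (length shared)) (trans length-shared (trans sum-lam (sym length-hs))))

  ¬choosable : ¬ IsLamChoosable k (l₀ ∷ lr) G
  ¬choosable choosable = ¬colourable (choosable L L-isLamAssignment)

PatternsClash-sym : ∀ {s s′} {P : Fin s → Pair} {P′ : Fin s′ → Pair} → PatternsClash P P′ → PatternsClash P′ P
PatternsClash-sym clash Y X Y∈ X∈ = let (r , r′ , e) = clash X Y X∈ Y∈ in r′ , r , sym e

PatternsClash-subst : ∀ {m m′ s s′} (e : m ≡ s) (e′ : m′ ≡ s′) {P : Fin s → Pair} {P′ : Fin s′ → Pair} →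
  PatternsClash P P′ → PatternsClash (P ∘ subst Fin e) (P′ ∘ subst Fin e′)
PatternsClash-subst refl refl clash = clash

-- The pairs of a part are the edges of a graph on four colours, and choosing one endpoint of
-- every edge yields a transversal (vertex cover) of it.  So two parts clash as soon as all
-- transversals of their graphs meet, which is decided by running through the subsets of colours.
IsTransversal : ∀ {s} → (Fin s → Pair) → Subset 4 → Set
IsTransversal P U = ∀ r → proj₁ (P r) ∈ˢ U ⊎ proj₂ (P r) ∈ˢ U

TransversalsMeet : ∀ {s s′} → (Fin s → Pair) → (Fin s′ → Pair) → Set
TransversalsMeet P P′ = ∀ U U′ → IsTransversal P U → IsTransversal P′ U′ → ∃[ a ] a ∈ˢ U × a ∈ˢ U′

all-subsets? : ∀ {n} {Q : Subset n → Set} → (∀ U → Dec (Q U)) → Dec (∀ U → Q U)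
all-subsets? Q? with anySubset? (λ U → ¬? (Q? U))
... | yes (U , ¬QU) = no λ all → ¬QU (all U)
... | no none = yes λ U → decidable-stable (Q? U) λ ¬QU → none (U , ¬QU)

transversalsMeet? : ∀ {s s′} (P : Fin s → Pair) (P′ : Fin s′ → Pair) → Dec (TransversalsMeet P P′)
transversalsMeet? P P′ = all-subsets? λ U → all-subsets? λ U′ →
  isTransversal? P U →-dec isTransversal? P′ U′ →-dec Fin.any? λ a → (a ∈ˢ? U) ×-dec (a ∈ˢ? U′)
  where
  isTransversal? : ∀ {s} (P : Fin s → Pair) U → Dec (IsTransversal P U)
  isTransversal? P U = Fin.all? λ r → (proj₁ (P r) ∈ˢ? U) ⊎-dec (proj₂ (P r) ∈ˢ? U)

hit? : ∀ {m} (X : Fin m → Fin 4) a → Dec (∃[ r ] X r ≡ a)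
hit? X a = Fin.any? λ r → X r ≟ᶠ a

image : ∀ {m} → (Fin m → Fin 4) → Subset 4
image X = tabulate λ a → does (hit? X a)

∈-image⁺ : ∀ {m} (X : Fin m → Fin 4) r → X r ∈ˢ image X
∈-image⁺ X r = lookup⇒[]= (X r) (image X)
  (trans (lookup∘tabulate (does ∘ hit? X) (X r)) (dec-true (hit? X (X r)) (r , refl)))

∈-image⁻ : ∀ {m} (X : Fin m → Fin 4) a → a ∈ˢ image X → ∃[ r ] X r ≡ a
∈-image⁻ X a a∈ with hit? X a | lookup∘tabulate (does ∘ hit? X) a
... | yes found | _ = found
... | no _ | e with trans (sym e) ([]=⇒lookup a∈)
... | ()

transversals-meet⇒clash : ∀ {s s′} {P : Fin s → Pair} {P′ : Fin s′ → Pair} →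
  TransversalsMeet P P′ → PatternsClash P P′
transversals-meet⇒clash meet X Y X∈ Y∈ =
  let (a , a∈X , a∈Y) = meet (image X) (image Y) (transversal X X∈) (transversal Y Y∈)
      (r , Xr≡a) = ∈-image⁻ X a a∈X
      (r′ , Yr′≡a) = ∈-image⁻ Y a a∈Y
  in r , r′ , trans Xr≡a (sym Yr′≡a)
  where
  transversal : ∀ {s} {P : Fin s → Pair} (Z : Fin s → Fin 4) → (∀ r → Z r ∈ᵖ P r) → IsTransversal P (image Z)
  transversal Z Z∈ r with Z∈ r
  ... | inj₁ e = inj₁ (subst (_∈ˢ image Z) e (∈-image⁺ Z r))
  ... | inj₂ e = inj₂ (subst (_∈ˢ image Z) e (∈-image⁺ Z r))

a b c d : Fin 4
a = zero
b = suc zero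
c = suc (suc zero)
d = suc (suc (suc zero))

triangle : Fin 3 → Pair
triangle = Vec.lookup ((a , b) ∷ (a , c) ∷ (b , c) ∷ [])

matching : Fin 2 → Pair
matching = Vec.lookup ((a , b) ∷ (c , d) ∷ [])

square : Fin 4 → Pair
square = Vec.lookup ((a , c) ∷ (a , d) ∷ (b , c) ∷ (b , d) ∷ [])

K₄-minus-cd : Fin 5 → Pair
K₄-minus-cd = Vec.lookup ((a , c) ∷ (a , d) ∷ (b , c) ∷ (b , d) ∷ (a , b) ∷ [])

K₄ : Fin 6 → Pair
K₄ = Vec.lookup ((a , c) ∷ (a , d) ∷ (b , c) ∷ (b , d) ∷ (a , b) ∷ (c , d) ∷ [])

clash-by-decision : ∀ {s s′} (P : Fin s → Pair) (P′ : Fin s′ → Pair) → {True (transversalsMeet? P P′)} →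
  PatternsClash P P′
clash-by-decision P P′ {meet} = transversals-meet⇒clash (toWitness meet)

K3*k-pattern : ∀ k → PairPattern (replicate k 3)
K3*k-pattern k = record
  { pairs = λ q → triangle ∘ subst Fin (lookup-replicate k 3 q)
  ; distinct = λ q r → from-yes (distinct? triangle) (subst Fin (lookup-replicate k 3 q) r)
  ; clash = λ q q′ _ → PatternsClash-subst (lookup-replicate k 3 q) (lookup-replicate k 3 q′)
      (clash-by-decision triangle triangle)
  }

K2,4,6*-pattern : ∀ m → PairPattern (2 ∷ 4 ∷ replicate m 6)
K2,4,6*-pattern m = record { pairs = pairs ; distinct = distinct ; clash = clash }
  where
  pairs : ∀ q → Fin (lookup (2 ∷ 4 ∷ replicate m 6) q) → Pair
  pairs zero = matching
  pairs (suc zero) = square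
  pairs (suc (suc t)) = K₄ ∘ subst Fin (lookup-replicate m 6 t)
  distinct : ∀ q → Distinct (pairs q)
  distinct zero = from-yes (distinct? matching)
  distinct (suc zero) = from-yes (distinct? square)
  distinct (suc (suc t)) r = from-yes (distinct? K₄) (subst Fin (lookup-replicate m 6 t) r)
  clash : ∀ q q′ → q ≢ q′ → PatternsClash (pairs q) (pairs q′)
  clash zero zero q≢q′ = ⊥-elim (q≢q′ refl)
  clash (suc zero) (suc zero) q≢q′ = ⊥-elim (q≢q′ refl)
  clash zero (suc zero) _ = clash-by-decision matching square
  clash (suc zero) zero _ = PatternsClash-sym (clash-by-decision matching square)
  clash zero (suc (suc t)) _ = PatternsClash-subst refl (lookup-replicate m 6 t) (clash-by-decision matching K₄)
  clash (suc (suc t)) zero _ = PatternsClash-subst (lookup-replicate m 6 t) refl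
    (PatternsClash-sym (clash-by-decision matching K₄))
  clash (suc zero) (suc (suc t)) _ = PatternsClash-subst refl (lookup-replicate m 6 t) (clash-by-decision square K₄)
  clash (suc (suc t)) (suc zero) _ = PatternsClash-subst (lookup-replicate m 6 t) refl
    (PatternsClash-sym (clash-by-decision square K₄))
  clash (suc (suc t)) (suc (suc t′)) _ = PatternsClash-subst (lookup-replicate m 6 t) (lookup-replicate m 6 t′)
    (clash-by-decision K₄ K₄)

K2,5*-pattern : ∀ m → PairPattern (2 ∷ replicate m 5)
K2,5*-pattern m = record { pairs = pairs ; distinct = distinct ; clash = clash }
  where
  pairs : ∀ q → Fin (lookup (2 ∷ replicate m 5) q) → Pair
  pairs zero = matching
  pairs (suc t) = K₄-minus-cd ∘ subst Fin (lookup-replicate m 5 t)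
  distinct : ∀ q → Distinct (pairs q)
  distinct zero = from-yes (distinct? matching)
  distinct (suc t) r = from-yes (distinct? K₄-minus-cd) (subst Fin (lookup-replicate m 5 t) r)
  clash : ∀ q q′ → q ≢ q′ → PatternsClash (pairs q) (pairs q′)
  clash zero zero q≢q′ = ⊥-elim (q≢q′ refl)
  clash zero (suc t) _ = PatternsClash-subst refl (lookup-replicate m 5 t) (clash-by-decision matching K₄-minus-cd)
  clash (suc t) zero _ = PatternsClash-subst (lookup-replicate m 5 t) refl
    (PatternsClash-sym (clash-by-decision matching K₄-minus-cd))
  clash (suc t) (suc t′) _ = PatternsClash-subst (lookup-replicate m 5 t) (lookup-replicate m 5 t′)
    (clash-by-decision K₄-minus-cd K₄-minus-cd)

all-ones⇒replicate : ∀ lam → All (_≡ 1) lam → lam ≡ replicate (sum lam) 1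
all-ones⇒replicate [] [] = refl
all-ones⇒replicate (_ ∷ lam) (refl ∷ ones) = cong (1 ∷_) (all-ones⇒replicate lam ones)

some-part-≥2 : ∀ lam → ¬ All (_≡ 1) lam → All (1 ≤_) lam → ∃[ p ] 2 ≤ lookup lam p
some-part-≥2 [] ¬ones [] = ⊥-elim (¬ones [])
some-part-≥2 (suc zero ∷ lam) ¬ones (_ ∷ positive) =
  let (p , 2≤λp) = some-part-≥2 lam (λ ones → ¬ones (refl ∷ ones)) positive in suc p , 2≤λp
some-part-≥2 (suc (suc _) ∷ lam) _ _ = zero , s≤s (s≤s z≤n)

strictly-from-pattern : ∀ k ps hs → length ps ≡ k → length hs ≡ k →
  IsSubgraph (CompleteMultipartite hs) (CompleteMultipartite ps) → PairPattern hs →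
  IsStrictlyColorable k (CompleteMultipartite ps)
strictly-from-pattern k ps hs length-ps length-hs H⊆G P = isLamChoosable-ones k ps length-ps , only-ones
  where
  only-ones : ∀ lam → IsPartition k lam → IsLamChoosable k lam (CompleteMultipartite ps) → lam ↭ replicate k 1
  only-ones lam (positive , sum≡k) choosable with All.all? (_≟ℕ 1) lam
  ... | yes ones = subst (λ m → lam ↭ replicate m 1) sum≡k (subst (lam ↭_) (all-ones⇒replicate lam ones) ↭-refl)
  ... | no ¬ones with lam | some-part-≥2 lam ¬ones positive | sum≡k
  ... | l₀ ∷ lr | (p , 2≤λp) | sum≡k′ =
    ⊥-elim (NonChoosable.¬choosable hs ps k length-hs H⊆G P l₀ lr p 2≤λp sum≡k′ choosable)

mainTheorem1 : (k : ℕ) → 3 ≤ k → (ps : List ℕ) → length ps ≡ k → All (1 ≤_) ps →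
    IsStrictlyColorable k (CompleteMultipartite ps) ⇔
    (IsSubgraph (CompleteMultipartite (replicate k 3)) (CompleteMultipartite ps)
    ⊎ (IsSubgraph (CompleteMultipartite (2 ∷ 4 ∷ replicate (k ∸ 2) 6)) (CompleteMultipartite ps)
    ⊎ IsSubgraph (CompleteMultipartite (2 ∷ replicate (k ∸ 1) 5)) (CompleteMultipartite ps)))
mainTheorem1 (suc (suc (suc n))) (s≤s (s≤s (s≤s _))) ps length-ps positive =
  mk⇔ (Classification.strictly⇒critical n ps length-ps positive) λ where
    (inj₁ H⊆G) → strictly-from-pattern _ ps _ length-ps (length-replicate _) H⊆G (K3*k-pattern _)
    (inj₂ (inj₁ H⊆G)) → strictly-from-pattern _ ps _ length-ps
      (cong (λ m → suc (suc m)) (length-replicate (suc n))) H⊆G (K2,4,6*-pattern (suc n))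
    (inj₂ (inj₂ H⊆G)) → strictly-from-pattern _ ps _ length-ps (cong suc (length-replicate (suc (suc n)))) H⊆G
      (K2,5*-pattern (suc (suc n)))
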